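{- Let $a,b\in\mathbb{Z}$ with $(a,b)\neq(0,0)$ and $f(x)=x^4+ax^2+bx$. Let $h_1,h_2,\rho$ be positive integers with $h_2\mid 2b$, put $c=2b/h_2$, $A=h_1^2h_2^2\rho^2+2a$, $G(u,v)=v^3+(h_1^2h_2^2u^2+2a)v+h_2c$, and define the quartic form $$K(Z,X,Y,W)=W^4h_1h_2\rho\, G(\rho,Z/W)-2\{W^4f(X/W)-W^4f(Y/W)\}.$$ There is a constant $C_0$ depending only on $a,b$ such that if $|A|>C_0$ then $K$ is non-singular, i.e. the projective surface $K=0$ in $\mathbb{P}^3$ has no singular points over $\overline{\mathbb{Q}}$. -}

module Defs where

open import Level using (Level; _⊔_) renaming (suc to lsuc)
open import Data.Nat using (ℕ; zero; suc)
open import Data.Integer as ℤ using (ℤ; +_; -[1+_])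
open import Data.Fin as Fin using (Fin)
import Data.Nat
import Data.List
import Data.List.Membership.Propositional
open import Relation.Binary.PropositionalEquality using (_≡_)
open import Data.List using (List; []; _∷_)
open import Data.Product using (Σ; ∃; _×_; _,_)
open import Relation.Nullary using (¬_)
open import Relation.Binary.Definitions using (Decidable)
open import Algebra.Bundles using (CommutativeRing)

infixl 6 _⊕_
infixl 7 _⊗_

data Expr : Set where
  var : Fin 4 → Expr
  con : ℤ → Expr
  _⊕_ : Expr → Expr → Expr
  _⊗_ : Expr → Expr → Expr

∂ : Fin 4 → Expr → Expr
∂ i (var j) with i Fin.≟ j
... | Relation.Nullary.yes _ = con (+ 1)
... | Relation.Nullary.no  _ = con (+ 0)
∂ i (con _) = con (+ 0)
∂ i (e ⊕ e′) = ∂ i e ⊕ ∂ i e′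
∂ i (e ⊗ e′) = ∂ i e ⊗ e′ ⊕ e ⊗ ∂ i e′

_^^_ : Expr → ℕ → Expr
e ^^ zero  = con (+ 1)
e ^^ suc n = e ⊗ (e ^^ n)

module _ {c ℓ : Level} (R : CommutativeRing c ℓ) where
  open CommutativeRing R

  ιℕ : ℕ → Carrier
  ιℕ zero    = 0#
  ιℕ (suc n) = 1# + ιℕ n

  ι : ℤ → Carrier
  ι (+ n)      = ιℕ n
  ι (-[1+ n ]) = - ιℕ (suc n)

  ⟦_⟧ : Expr → (Fin 4 → Carrier) → Carrier
  ⟦ var i ⟧ x   = x i
  ⟦ con k ⟧ x   = ι k
  ⟦ e ⊕ e′ ⟧ x  = ⟦ e ⟧ x + ⟦ e′ ⟧ x
  ⟦ e ⊗ e′ ⟧ x  = ⟦ e ⟧ x * ⟦ e′ ⟧ x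

  evalPoly : List Carrier → Carrier → Carrier
  evalPoly []       t = 0#
  evalPoly (c ∷ cs) t = c + t * evalPoly cs t

  -- monic polynomial t^(n+1) + c_n t^n + … + c₀ from [c₀,…,c_n]
  evalMonic : List Carrier → Carrier → Carrier
  evalMonic []       t = t
  evalMonic (c ∷ cs) t = c + t * evalMonic cs t

  SingularPoint : Expr → (Fin 4 → Carrier) → Set ℓ
  SingularPoint e x =
    (∃ λ i → ¬ (x i ≈ 0#)) × (⟦ e ⟧ x ≈ 0#) × (∀ i → ⟦ ∂ i e ⟧ x ≈ 0#)

-- An algebraic closure of ℚ (a model of ℚ̄): a field of characteristic 0
-- which is algebraically closed and algebraic over ℚ (equivalently over ℤ).

record AlgebraicClosureOfℚ (c ℓ : Level) : Set (lsuc (c ⊔ ℓ)) where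
  field
    R : CommutativeRing c ℓ
  open CommutativeRing R
  field
    _≟_         : Decidable _≈_
    1≉0         : ¬ (1# ≈ 0#)
    inverse     : ∀ x → ¬ (x ≈ 0#) → ∃ λ y → x * y ≈ 1#
    char0       : ∀ n → ¬ (ι R (+ suc n) ≈ 0#)
    algClosed   : ∀ (cs : List Carrier) → ∃ λ t → evalMonic R cs t ≈ 0#
    algebraic   : ∀ x → Σ (List ℤ) λ ds →
                    (∃ λ k → Data.List.Membership.Propositional._∈_ k ds × ¬ (k ≡ + 0)) ×
                    evalPoly R (Data.List.map (ι R) ds) x ≈ 0#

-- The objects of the lemma.  Variables: 0 ↦ Z, 1 ↦ X, 2 ↦ Y, 3 ↦ W.

Zv Xv Yv Wv : Expr
Zv = var Fin.zero
Xv = var (Fin.suc Fin.zero)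
Yv = var (Fin.suc (Fin.suc Fin.zero))
Wv = var (Fin.suc (Fin.suc (Fin.suc Fin.zero)))

Aconst : ℤ → ℕ → ℕ → ℕ → ℤ
Aconst a h₁ h₂ ρ = + (h₁ ℕ.* h₁ ℕ.* h₂ ℕ.* h₂ ℕ.* ρ ℕ.* ρ) ℤ.+ (+ 2) ℤ.* a
  where import Data.Nat as ℕ

-- homogenisation W⁴ f(X/W) of f(x) = x⁴ + a x² + b x
Fhom : ℤ → ℤ → Expr → Expr → Expr
Fhom a b X W = X ^^ 4 ⊕ con a ⊗ X ^^ 2 ⊗ W ^^ 2 ⊕ con b ⊗ X ⊗ W ^^ 3

-- homogenisation W³ G(u, Z/W) of G(u,v) = v³ + (h₁²h₂²u² + 2a) v + h₂ c
Ghom : ℤ → (h₁ h₂ u : ℕ) → (c : ℤ) → Expr → Expr → Expr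
Ghom a h₁ h₂ u c Z W =
  Z ^^ 3 ⊕ con (Aconst a h₁ h₂ u) ⊗ Z ⊗ W ^^ 2 ⊕ con (+ h₂ ℤ.* c) ⊗ W ^^ 3

Kform : (a b : ℤ) (h₁ h₂ ρ : ℕ) (c : ℤ) → Expr
Kform a b h₁ h₂ ρ c =
  con (+ (h₁ Data.Nat.* h₂ Data.Nat.* ρ)) ⊗ Wv ⊗ Ghom a h₁ h₂ ρ c Zv Wv
  ⊕ con (ℤ.- + 2) ⊗ (Fhom a b Xv Wv ⊕ con (ℤ.- + 1) ⊗ Fhom a b Yv Wv)

module Submission where

-- Write η = h₁h₂ρ, κ = h₂c, α = a, β = b, so that
--   K = η·W·(Z³ + AZW² + κW³) − 2(F(X,W) − F(Y,W)),   F(X,W) = X⁴ + αX²W² + βXW³,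
-- with κ = 2β and η² = A − 2α.  At a singular point the partial derivatives
-- give ηW(3Z² + AW²) = 0 and show that X, Y are roots of 4T³ + 2αTW² + βW³.
-- If W = 0 this forces Z = X = Y = 0, which is not a projective point.  If
-- W ≠ 0 the coordinates are eliminated one by one, each step an explicit
-- polynomial identity checked by a ring solver whose integer coefficients are
-- mapped into the field: first Z (using K = 0); then either X = Y, giving
-- A³ + 27b² = 0, or X ≠ Y, where X + Y solves a cubic, and eliminating η,
-- X − Y and finally X + Y (by a resultant) gives a second polynomial equation
-- in A alone.  Both eliminants have integer coefficients depending on a, b and
-- leading coefficients 1 and 2³⁶, so an explicit bound C₀(a, b)
-- (`eliminantBound`) excludes their roots with |A| > C₀; characteristic 0
-- transports the vanishing from the field back to ℤ.

open import Level using (0ℓ)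
open import Data.Nat using (ℕ)
open import Data.Integer using (ℤ)
open import Algebra.Bundles using (CommutativeRing)
open import Defs using (AlgebraicClosureOfℚ)

module IntegerPolynomials where

  open import Data.Nat as ℕ using (ℕ; zero; suc; _≤_; _<_; z≤n; s≤s; NonZero; compare; Ordering; less; equal; greater)
  import Data.Nat.Properties as ℕP
  open import Data.Integer as ℤ using (ℤ; +_; ∣_∣)
  import Data.Integer.Properties as ℤP
  open import Relation.Binary.PropositionalEquality using (_≡_; refl; trans; cong; cong₂; subst)
  open import Relation.Nullary using (¬_)
  open import Data.Integer.Solver using (module +-*-Solver)
  open +-*-Solver using (_:+_; _:-_; _:*_; _:=_; con) renaming (solve to solveℤ)
  open import Data.Nat.Solver using () renaming (module +-*-Solver to ℕ-Solver)
  open ℕ-Solver using () renaming (_:+_ to _:+ₙ_; _:*_ to _:*ₙ_; _:=_ to _:=ₙ_; solve to solveℕ)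

  infixl 6 _⊞_
  infixl 7 _⊠_

  data IntPoly : Set where
    varA   : IntPoly
    cst    : ℤ → IntPoly
    _⊞_ _⊠_ : IntPoly → IntPoly → IntPoly

  eval : IntPoly → ℤ → ℤ
  eval varA    A = A
  eval (cst c) A = c
  eval (p ⊞ q) A = eval p A ℤ.+ eval q A
  eval (p ⊠ q) A = eval p A ℤ.* eval q A

  -- The leading coefficient may vanish (for sums of equal degree); the
  -- estimate below holds regardless.
  sumDegree : ∀ {m n} → Ordering m n → ℕ
  sumDegree (less m k)    = suc (m ℕ.+ k)
  sumDegree (equal m)     = m
  sumDegree (greater n k) = suc (n ℕ.+ k)

  sumLeading : ∀ {m n} → ℤ → ℤ → Ordering m n → ℤ
  sumLeading lp lq (less _ _)    = lq
  sumLeading lp lq (equal _)     = lp ℤ.+ lq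
  sumLeading lp lq (greater _ _) = lp

  sumBound : ∀ {m n} → ℤ → ℤ → ℕ → ℕ → Ordering m n → ℕ
  sumBound lp lq bp bq (less _ _)    = bq ℕ.+ bp ℕ.+ ∣ lp ∣
  sumBound lp lq bp bq (equal _)     = bp ℕ.+ bq
  sumBound lp lq bp bq (greater _ _) = bp ℕ.+ bq ℕ.+ ∣ lq ∣

  degree : IntPoly → ℕ
  leading : IntPoly → ℤ
  bound : IntPoly → ℕ
  degree varA    = 1
  degree (cst c) = 0
  degree (p ⊞ q) = sumDegree (compare (degree p) (degree q))
  degree (p ⊠ q) = degree p ℕ.+ degree q
  leading varA    = + 1
  leading (cst c) = c
  leading (p ⊞ q) = sumLeading (leading p) (leading q) (compare (degree p) (degree q))
  leading (p ⊠ q) = leading p ℤ.* leading q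
  bound varA    = 0
  bound (cst c) = 0
  bound (p ⊞ q) = sumBound (leading p) (leading q) (bound p) (bound q) (compare (degree p) (degree q))
  bound (p ⊠ q) = ∣ leading p ∣ ℕ.* bound q ℕ.+ ∣ leading q ∣ ℕ.* bound p ℕ.+ bound p ℕ.* bound q

  -- `Approx A d l b e`: the integer e equals l·Aᵈ up to an error of size at
  -- most b·|A|ᵈ⁻¹, written multiplicatively to avoid division by |A|.
  Approx : ℤ → ℕ → ℤ → ℕ → ℤ → Set
  Approx A d l b e = ∣ A ∣ ℕ.* ∣ e ℤ.- l ℤ.* A ℤ.^ d ∣ ≤ b ℕ.* ∣ A ∣ ℕ.^ d

  ∣^∣ : ∀ A n → ∣ A ℤ.^ n ∣ ≡ ∣ A ∣ ℕ.^ n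
  ∣^∣ A zero    = refl
  ∣^∣ A (suc n) = trans (ℤP.abs-* A (A ℤ.^ n)) (cong (∣ A ∣ ℕ.*_) (∣^∣ A n))

  ∣l*A^d∣ : ∀ A d l → ∣ l ℤ.* A ℤ.^ d ∣ ≡ ∣ l ∣ ℕ.* ∣ A ∣ ℕ.^ d
  ∣l*A^d∣ A d l = trans (ℤP.abs-* l (A ℤ.^ d)) (cong (∣ l ∣ ℕ.*_) (∣^∣ A d))

  ∣e∣≤ : ∀ A d l e → ∣ e ∣ ≤ ∣ l ∣ ℕ.* ∣ A ∣ ℕ.^ d ℕ.+ ∣ e ℤ.- l ℤ.* A ℤ.^ d ∣
  ∣e∣≤ A d l e = begin
    ∣ e ∣                                       ≡⟨ cong ∣_∣ (split e l (A ℤ.^ d)) ⟩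
    ∣ l ℤ.* A ℤ.^ d ℤ.+ (e ℤ.- l ℤ.* A ℤ.^ d) ∣ ≤⟨ ℤP.∣i+j∣≤∣i∣+∣j∣ (l ℤ.* A ℤ.^ d) _ ⟩
    ∣ l ℤ.* A ℤ.^ d ∣ ℕ.+ ∣ e ℤ.- l ℤ.* A ℤ.^ d ∣ ≡⟨ cong (ℕ._+ ∣ e ℤ.- l ℤ.* A ℤ.^ d ∣) (∣l*A^d∣ A d l) ⟩
    ∣ l ∣ ℕ.* ∣ A ∣ ℕ.^ d ℕ.+ ∣ e ℤ.- l ℤ.* A ℤ.^ d ∣ ∎
    where
    open ℕP.≤-Reasoning
    split : ∀ e l P → e ≡ l ℤ.* P ℤ.+ (e ℤ.- l ℤ.* P)
    split = solveℤ 3 (λ e l P → e := l :* P :+ (e :- l :* P)) refl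

  module _ (A : ℤ) .{{_ : NonZero ∣ A ∣}} where
    private
      a : ℕ
      a = ∣ A ∣
      open ℕP.≤-Reasoning

    approx-var : Approx A 1 (+ 1) 0 A
    approx-var = ℕP.≤-reflexive (trans (cong (λ z → a ℕ.* ∣ z ∣) (exact A)) (ℕP.*-zeroʳ a))
      where
      exact : ∀ A → A ℤ.- + 1 ℤ.* (A ℤ.* + 1) ≡ + 0
      exact = solveℤ 1 (λ A → A :- con (+ 1) :* (A :* con (+ 1)) := con (+ 0)) refl

    approx-cst : ∀ c → Approx A 0 c 0 c
    approx-cst c = ℕP.≤-reflexive (trans (cong (λ z → a ℕ.* ∣ z ∣) (exact c)) (ℕP.*-zeroʳ a))
      where
      exact : ∀ c → c ℤ.- c ℤ.* + 1 ≡ + 0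
      exact = solveℤ 1 (λ c → c :- c :* con (+ 1) := con (+ 0)) refl

    approx-+-equal : ∀ d lp lq bp bq ep eq → Approx A d lp bp ep → Approx A d lq bq eq →
                     Approx A d (lp ℤ.+ lq) (bp ℕ.+ bq) (ep ℤ.+ eq)
    approx-+-equal d lp lq bp bq ep eq hp hq = begin
      a ℕ.* ∣ ep ℤ.+ eq ℤ.- (lp ℤ.+ lq) ℤ.* P ∣ ≡⟨ cong (λ z → a ℕ.* ∣ z ∣) (regroup ep eq lp lq P) ⟩
      a ℕ.* ∣ rp ℤ.+ rq ∣                       ≤⟨ ℕP.*-monoʳ-≤ a (ℤP.∣i+j∣≤∣i∣+∣j∣ rp rq) ⟩
      a ℕ.* (∣ rp ∣ ℕ.+ ∣ rq ∣)                 ≡⟨ ℕP.*-distribˡ-+ a _ _ ⟩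
      a ℕ.* ∣ rp ∣ ℕ.+ a ℕ.* ∣ rq ∣             ≤⟨ ℕP.+-mono-≤ hp hq ⟩
      bp ℕ.* a ℕ.^ d ℕ.+ bq ℕ.* a ℕ.^ d         ≡⟨ ℕP.*-distribʳ-+ (a ℕ.^ d) bp bq ⟨
      (bp ℕ.+ bq) ℕ.* a ℕ.^ d                   ∎
      where
      P rp rq : ℤ
      P = A ℤ.^ d
      rp = ep ℤ.- lp ℤ.* P
      rq = eq ℤ.- lq ℤ.* P
      regroup : ∀ ep eq lp lq P → ep ℤ.+ eq ℤ.- (lp ℤ.+ lq) ℤ.* P ≡ (ep ℤ.- lp ℤ.* P) ℤ.+ (eq ℤ.- lq ℤ.* P)
      regroup = solveℤ 5 (λ ep eq lp lq P → ep :+ eq :- (lp :+ lq) :* P := (ep :- lp :* P) :+ (eq :- lq :* P)) refl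

    approx-+-dominant : ∀ dL dS lL lS bL bS eL eS → dS < dL → Approx A dL lL bL eL → Approx A dS lS bS eS →
                        Approx A dL lL (bL ℕ.+ bS ℕ.+ ∣ lS ∣) (eL ℤ.+ eS)
    approx-+-dominant dL dS lL lS bL bS eL eS dS<dL hL hS = begin
      a ℕ.* ∣ eL ℤ.+ eS ℤ.- lL ℤ.* P ∣         ≡⟨ cong (λ z → a ℕ.* ∣ z ∣) (regroup eL eS lL P) ⟩
      a ℕ.* ∣ rL ℤ.+ eS ∣                      ≤⟨ ℕP.*-monoʳ-≤ a (ℤP.∣i+j∣≤∣i∣+∣j∣ rL eS) ⟩
      a ℕ.* (∣ rL ∣ ℕ.+ ∣ eS ∣)                ≡⟨ ℕP.*-distribˡ-+ a _ _ ⟩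
      a ℕ.* ∣ rL ∣ ℕ.+ a ℕ.* ∣ eS ∣            ≤⟨ ℕP.+-mono-≤ hL (ℕP.*-monoʳ-≤ a (∣e∣≤ A dS lS eS)) ⟩
      bL ℕ.* a ℕ.^ dL ℕ.+ a ℕ.* (∣ lS ∣ ℕ.* a ℕ.^ dS ℕ.+ ∣ rS ∣)
        ≡⟨ cong (bL ℕ.* a ℕ.^ dL ℕ.+_) (distribute a (∣ lS ∣) (a ℕ.^ dS) (∣ rS ∣)) ⟩
      bL ℕ.* a ℕ.^ dL ℕ.+ (∣ lS ∣ ℕ.* a ℕ.^ suc dS ℕ.+ a ℕ.* ∣ rS ∣)
        ≤⟨ ℕP.+-monoʳ-≤ (bL ℕ.* a ℕ.^ dL) (ℕP.+-mono-≤ (ℕP.*-monoʳ-≤ ∣ lS ∣ (ℕP.^-monoʳ-≤ a dS<dL))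
                                                       (ℕP.≤-trans hS (ℕP.*-monoʳ-≤ bS (ℕP.^-monoʳ-≤ a (ℕP.<⇒≤ dS<dL))))) ⟩
      bL ℕ.* a ℕ.^ dL ℕ.+ (∣ lS ∣ ℕ.* a ℕ.^ dL ℕ.+ bS ℕ.* a ℕ.^ dL)
        ≡⟨ collect bL (∣ lS ∣) bS (a ℕ.^ dL) ⟩
      (bL ℕ.+ bS ℕ.+ ∣ lS ∣) ℕ.* a ℕ.^ dL      ∎
      where
      P rL rS : ℤ
      P = A ℤ.^ dL
      rL = eL ℤ.- lL ℤ.* P
      rS = eS ℤ.- lS ℤ.* A ℤ.^ dS
      regroup : ∀ eL eS lL P → eL ℤ.+ eS ℤ.- lL ℤ.* P ≡ (eL ℤ.- lL ℤ.* P) ℤ.+ eS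
      regroup = solveℤ 4 (λ eL eS lL P → eL :+ eS :- lL :* P := (eL :- lL :* P) :+ eS) refl
      distribute : ∀ a l p r → a ℕ.* (l ℕ.* p ℕ.+ r) ≡ l ℕ.* (a ℕ.* p) ℕ.+ a ℕ.* r
      distribute = solveℕ 4 (λ a l p r → a :*ₙ (l :*ₙ p :+ₙ r) :=ₙ l :*ₙ (a :*ₙ p) :+ₙ a :*ₙ r) refl
      collect : ∀ bL lS bS p → bL ℕ.* p ℕ.+ (lS ℕ.* p ℕ.+ bS ℕ.* p) ≡ (bL ℕ.+ bS ℕ.+ lS) ℕ.* p
      collect = solveℕ 4 (λ bL lS bS p → bL :*ₙ p :+ₙ (lS :*ₙ p :+ₙ bS :*ₙ p) :=ₙ (bL :+ₙ bS :+ₙ lS) :*ₙ p) refl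

    approx-+ : ∀ dp dq lp lq bp bq ep eq → Approx A dp lp bp ep → Approx A dq lq bq eq → (o : Ordering dp dq) →
               Approx A (sumDegree o) (sumLeading lp lq o) (sumBound lp lq bp bq o) (ep ℤ.+ eq)
    approx-+ dp _ lp lq bp bq ep eq hp hq (less _ k) =
      subst (Approx A (suc (dp ℕ.+ k)) lq (bq ℕ.+ bp ℕ.+ ∣ lp ∣)) (ℤP.+-comm eq ep)
        (approx-+-dominant _ dp lq lp bq bp eq ep (s≤s (ℕP.m≤m+n dp k)) hq hp)
    approx-+ dp _ lp lq bp bq ep eq hp hq (equal _) = approx-+-equal dp lp lq bp bq ep eq hp hq
    approx-+ _ dq lp lq bp bq ep eq hp hq (greater _ k) =
      approx-+-dominant _ dq lp lq bp bq ep eq (s≤s (ℕP.m≤m+n dq k)) hp hq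

    approx-* : ∀ dp dq lp lq bp bq ep eq → Approx A dp lp bp ep → Approx A dq lq bq eq →
               Approx A (dp ℕ.+ dq) (lp ℤ.* lq) (∣ lp ∣ ℕ.* bq ℕ.+ ∣ lq ∣ ℕ.* bp ℕ.+ bp ℕ.* bq) (ep ℤ.* eq)
    approx-* dp dq lp lq bp bq ep eq hp hq = begin
      a ℕ.* ∣ ep ℤ.* eq ℤ.- lp ℤ.* lq ℤ.* A ℤ.^ (dp ℕ.+ dq) ∣
        ≡⟨ cong (λ z → a ℕ.* ∣ ep ℤ.* eq ℤ.- lp ℤ.* lq ℤ.* z ∣) (ℤP.^-distribˡ-+-* A dp dq) ⟩
      a ℕ.* ∣ ep ℤ.* eq ℤ.- lp ℤ.* lq ℤ.* (P ℤ.* Q) ∣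
        ≡⟨ cong (λ z → a ℕ.* ∣ z ∣) (expand ep eq lp lq P Q) ⟩
      a ℕ.* ∣ lp ℤ.* P ℤ.* rq ℤ.+ rp ℤ.* (lq ℤ.* Q) ℤ.+ rp ℤ.* rq ∣
        ≤⟨ ℕP.*-monoʳ-≤ a (triangle₃ (lp ℤ.* P ℤ.* rq) (rp ℤ.* (lq ℤ.* Q)) (rp ℤ.* rq)) ⟩
      a ℕ.* (∣ lp ℤ.* P ℤ.* rq ∣ ℕ.+ ∣ rp ℤ.* (lq ℤ.* Q) ∣ ℕ.+ ∣ rp ℤ.* rq ∣)
        ≡⟨ cong (a ℕ.*_) (cong₂ ℕ._+_ (cong₂ ℕ._+_ abs₁ abs₂) (ℤP.abs-* rp rq)) ⟩
      a ℕ.* (Lp ℕ.* p ℕ.* Rq ℕ.+ Rp ℕ.* (Lq ℕ.* q) ℕ.+ Rp ℕ.* Rq)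
        ≡⟨ distribute a Lp Lq p q Rp Rq ⟩
      Lp ℕ.* p ℕ.* (a ℕ.* Rq) ℕ.+ Lq ℕ.* q ℕ.* (a ℕ.* Rp) ℕ.+ (a ℕ.* Rp) ℕ.* Rq
        ≤⟨ ℕP.+-mono-≤ (ℕP.+-mono-≤ (ℕP.*-monoʳ-≤ (Lp ℕ.* p) hq) (ℕP.*-monoʳ-≤ (Lq ℕ.* q) hp))
                       (ℕP.*-mono-≤ hp (ℕP.≤-trans (ℕP.m≤n*m Rq a) hq)) ⟩
      Lp ℕ.* p ℕ.* (bq ℕ.* q) ℕ.+ Lq ℕ.* q ℕ.* (bp ℕ.* p) ℕ.+ (bp ℕ.* p) ℕ.* (bq ℕ.* q)
        ≡⟨ collect Lp Lq bp bq p q ⟩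
      (Lp ℕ.* bq ℕ.+ Lq ℕ.* bp ℕ.+ bp ℕ.* bq) ℕ.* (p ℕ.* q)
        ≡⟨ cong ((Lp ℕ.* bq ℕ.+ Lq ℕ.* bp ℕ.+ bp ℕ.* bq) ℕ.*_) (ℕP.^-distribˡ-+-* a dp dq) ⟨
      (Lp ℕ.* bq ℕ.+ Lq ℕ.* bp ℕ.+ bp ℕ.* bq) ℕ.* a ℕ.^ (dp ℕ.+ dq) ∎
      where
      P Q rp rq : ℤ
      P = A ℤ.^ dp
      Q = A ℤ.^ dq
      rp = ep ℤ.- lp ℤ.* P
      rq = eq ℤ.- lq ℤ.* Q
      p q Lp Lq Rp Rq : ℕ
      p = a ℕ.^ dp
      q = a ℕ.^ dq
      Lp = ∣ lp ∣
      Lq = ∣ lq ∣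
      Rp = ∣ rp ∣
      Rq = ∣ rq ∣
      expand : ∀ ep eq lp lq P Q → ep ℤ.* eq ℤ.- lp ℤ.* lq ℤ.* (P ℤ.* Q) ≡
               lp ℤ.* P ℤ.* (eq ℤ.- lq ℤ.* Q) ℤ.+ (ep ℤ.- lp ℤ.* P) ℤ.* (lq ℤ.* Q) ℤ.+ (ep ℤ.- lp ℤ.* P) ℤ.* (eq ℤ.- lq ℤ.* Q)
      expand = solveℤ 6 (λ ep eq lp lq P Q → ep :* eq :- lp :* lq :* (P :* Q) :=
               lp :* P :* (eq :- lq :* Q) :+ (ep :- lp :* P) :* (lq :* Q) :+ (ep :- lp :* P) :* (eq :- lq :* Q)) refl
      triangle₃ : ∀ i j k → ∣ i ℤ.+ j ℤ.+ k ∣ ≤ ∣ i ∣ ℕ.+ ∣ j ∣ ℕ.+ ∣ k ∣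
      triangle₃ i j k = ℕP.≤-trans (ℤP.∣i+j∣≤∣i∣+∣j∣ (i ℤ.+ j) k) (ℕP.+-monoˡ-≤ ∣ k ∣ (ℤP.∣i+j∣≤∣i∣+∣j∣ i j))
      abs₁ : ∣ lp ℤ.* P ℤ.* rq ∣ ≡ Lp ℕ.* p ℕ.* Rq
      abs₁ = trans (ℤP.abs-* (lp ℤ.* P) rq) (cong (ℕ._* Rq) (∣l*A^d∣ A dp lp))
      abs₂ : ∣ rp ℤ.* (lq ℤ.* Q) ∣ ≡ Rp ℕ.* (Lq ℕ.* q)
      abs₂ = trans (ℤP.abs-* rp (lq ℤ.* Q)) (cong (Rp ℕ.*_) (∣l*A^d∣ A dq lq))
      distribute : ∀ a lp lq p q x y → a ℕ.* (lp ℕ.* p ℕ.* y ℕ.+ x ℕ.* (lq ℕ.* q) ℕ.+ x ℕ.* y) ≡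
                   lp ℕ.* p ℕ.* (a ℕ.* y) ℕ.+ lq ℕ.* q ℕ.* (a ℕ.* x) ℕ.+ (a ℕ.* x) ℕ.* y
      distribute = solveℕ 7 (λ a lp lq p q x y → a :*ₙ (lp :*ₙ p :*ₙ y :+ₙ x :*ₙ (lq :*ₙ q) :+ₙ x :*ₙ y) :=ₙ
                   lp :*ₙ p :*ₙ (a :*ₙ y) :+ₙ lq :*ₙ q :*ₙ (a :*ₙ x) :+ₙ (a :*ₙ x) :*ₙ y) refl
      collect : ∀ lp lq bp bq p q → lp ℕ.* p ℕ.* (bq ℕ.* q) ℕ.+ lq ℕ.* q ℕ.* (bp ℕ.* p) ℕ.+ (bp ℕ.* p) ℕ.* (bq ℕ.* q) ≡
                (lp ℕ.* bq ℕ.+ lq ℕ.* bp ℕ.+ bp ℕ.* bq) ℕ.* (p ℕ.* q)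
      collect = solveℕ 6 (λ lp lq bp bq p q → lp :*ₙ p :*ₙ (bq :*ₙ q) :+ₙ lq :*ₙ q :*ₙ (bp :*ₙ p) :+ₙ (bp :*ₙ p) :*ₙ (bq :*ₙ q) :=ₙ
                (lp :*ₙ bq :+ₙ lq :*ₙ bp :+ₙ bp :*ₙ bq) :*ₙ (p :*ₙ q)) refl

    approx : ∀ p → Approx A (degree p) (leading p) (bound p) (eval p A)
    approx varA    = approx-var
    approx (cst c) = approx-cst c
    approx (p ⊞ q) = approx-+ (degree p) (degree q) (leading p) (leading q) (bound p) (bound q)
                       (eval p A) (eval q A) (approx p) (approx q) (compare (degree p) (degree q))
    approx (p ⊠ q) = approx-* (degree p) (degree q) (leading p) (leading q) (bound p) (bound q)
                       (eval p A) (eval q A) (approx p) (approx q)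

  noLargeRoot : ∀ p A → ¬ (leading p ≡ + 0) → bound p < ∣ A ∣ → ¬ (eval p A ≡ + 0)
  noLargeRoot p A l≢0 b<a root = ℕP.<⇒≱ b<a (begin
    ∣ A ∣                  ≤⟨ ℕP.m≤m*n ∣ A ∣ ∣ leading p ∣ {{∣l∣≢0}} ⟩
    ∣ A ∣ ℕ.* ∣ leading p ∣ ≤⟨ ℕP.*-cancelʳ-≤ _ (bound p) (∣ A ∣ ℕ.^ degree p) {{ℕP.m^n≢0 ∣ A ∣ (degree p)}} scaled ⟩
    bound p                ∎)
    where
    open ℕP.≤-Reasoning
    instance
      ∣A∣≢0 : NonZero ∣ A ∣
      ∣A∣≢0 = ℕ.>-nonZero (ℕP.≤-<-trans z≤n b<a)
    ∣l∣≢0 : NonZero ∣ leading p ∣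
    ∣l∣≢0 = ℕ.≢-nonZero (λ eq → l≢0 (ℤP.∣i∣≡0⇒i≡0 eq))
    -- at a root, the error term is the whole leading term
    error≡leading : ∣ eval p A ℤ.- leading p ℤ.* A ℤ.^ degree p ∣ ≡ ∣ leading p ∣ ℕ.* ∣ A ∣ ℕ.^ degree p
    error≡leading = begin-equality
      ∣ eval p A ℤ.- leading p ℤ.* A ℤ.^ degree p ∣ ≡⟨ cong (λ z → ∣ z ℤ.- leading p ℤ.* A ℤ.^ degree p ∣) root ⟩
      ∣ + 0 ℤ.- leading p ℤ.* A ℤ.^ degree p ∣      ≡⟨ cong ∣_∣ (ℤP.+-identityˡ (ℤ.- (leading p ℤ.* A ℤ.^ degree p))) ⟩
      ∣ ℤ.- (leading p ℤ.* A ℤ.^ degree p) ∣        ≡⟨ ℤP.∣-i∣≡∣i∣ (leading p ℤ.* A ℤ.^ degree p) ⟩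
      ∣ leading p ℤ.* A ℤ.^ degree p ∣              ≡⟨ ∣l*A^d∣ A (degree p) (leading p) ⟩
      ∣ leading p ∣ ℕ.* ∣ A ∣ ℕ.^ degree p          ∎
    scaled : ∣ A ∣ ℕ.* ∣ leading p ∣ ℕ.* ∣ A ∣ ℕ.^ degree p ≤ bound p ℕ.* ∣ A ∣ ℕ.^ degree p
    scaled = begin
      ∣ A ∣ ℕ.* ∣ leading p ∣ ℕ.* ∣ A ∣ ℕ.^ degree p   ≡⟨ ℕP.*-assoc ∣ A ∣ _ _ ⟩
      ∣ A ∣ ℕ.* (∣ leading p ∣ ℕ.* ∣ A ∣ ℕ.^ degree p) ≡⟨ cong (∣ A ∣ ℕ.*_) error≡leading ⟨
      ∣ A ∣ ℕ.* ∣ eval p A ℤ.- leading p ℤ.* A ℤ.^ degree p ∣ ≤⟨ approx A p ⟩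
      bound p ℕ.* ∣ A ∣ ℕ.^ degree p                  ∎

-- The map ι : ℤ → R of Defs is a ring homomorphism; through it the ring solver
-- checks identities with integer coefficients in any commutative ring R.
module IntegerCoefficients (R : CommutativeRing 0ℓ 0ℓ) where

  open import Data.Nat as ℕ using (ℕ; zero; suc)
  open import Data.Integer as ℤ using (ℤ; +_; -[1+_]; _⊖_; _◃_; sign; ∣_∣)
  import Data.Integer.Properties as ℤP
  open import Data.Sign as Sign using (Sign)
  open import Data.Bool using (Bool; true; false; T)
  open import Data.Maybe using (nothing)
  open import Data.Vec using (Vec)
  open import Relation.Binary.PropositionalEquality as ≡ using (_≡_)
  import Algebra.Solver.CommutativeMonoid
  import Defs

  open CommutativeRing R
  open import Relation.Binary.Reasoning.Setoid setoid
  open import Algebra.Properties.Ring ring using (-0#≈0#; -‿involutive; -‿+-comm; -1*x≈-x)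
  open import Algebra.Definitions.RawMonoid +-rawMonoid using (_×_)
  open import Algebra.Properties.Semiring.Mult semiring using (×-homo-+; ×1-homo-*)
  open import Tactic.RingSolver.Core.AlmostCommutativeRing
    using (fromCommutativeRing)
  open import Tactic.RingSolver.Core.Polynomial.Parameters using (Homomorphism)
  open import Tactic.RingSolver.Core.Expression using (Expr; Κ; Ι; _⊕_; _⊗_; ⊝_; _⊛_; module Eval)
  module +-CM = Algebra.Solver.CommutativeMonoid +-commutativeMonoid
  module *-CM = Algebra.Solver.CommutativeMonoid *-commutativeMonoid

  ιℕ : ℕ → Carrier
  ιℕ = Defs.ιℕ R

  ι : ℤ → Carrier
  ι = Defs.ι R

  -- ιℕ n is the n-fold sum of 1#, so it inherits the semiring laws of _×_.
  ιℕ≈×1 : ∀ n → ιℕ n ≈ n × 1#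
  ιℕ≈×1 zero    = refl
  ιℕ≈×1 (suc n) = +-congˡ (ιℕ≈×1 n)

  ιℕ-+ : ∀ m n → ιℕ (m ℕ.+ n) ≈ ιℕ m + ιℕ n
  ιℕ-+ m n = begin
    ιℕ (m ℕ.+ n)     ≈⟨ ιℕ≈×1 (m ℕ.+ n) ⟩
    (m ℕ.+ n) × 1#   ≈⟨ ×-homo-+ 1# m n ⟩
    m × 1# + n × 1#  ≈⟨ +-cong (ιℕ≈×1 m) (ιℕ≈×1 n) ⟨
    ιℕ m + ιℕ n      ∎

  ιℕ-* : ∀ m n → ιℕ (m ℕ.* n) ≈ ιℕ m * ιℕ n
  ιℕ-* m n = begin
    ιℕ (m ℕ.* n)         ≈⟨ ιℕ≈×1 (m ℕ.* n) ⟩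
    (m ℕ.* n) × 1#       ≈⟨ ×1-homo-* m n ⟩
    (m × 1#) * (n × 1#)  ≈⟨ *-cong (ιℕ≈×1 m) (ιℕ≈×1 n) ⟨
    ιℕ m * ιℕ n          ∎

  -- ι on differences of naturals, via the additive form ι (m ⊖ n) + ιℕ n ≈ ιℕ m.
  ι-⊖+ : ∀ m n → ι (m ⊖ n) + ιℕ n ≈ ιℕ m
  ι-⊖+ m       zero    = +-identityʳ (ιℕ m)
  ι-⊖+ zero    (suc n) = -‿inverseˡ (ιℕ (suc n))
  ι-⊖+ (suc m) (suc n) = begin
    ι (suc m ⊖ suc n) + (1# + ιℕ n)   ≡⟨ ≡.cong (λ k → ι k + (1# + ιℕ n)) (ℤP.[1+m]⊖[1+n]≡m⊖n m n) ⟩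
    ι (m ⊖ n) + (1# + ιℕ n)           ≈⟨ exchange (ι (m ⊖ n)) 1# (ιℕ n) ⟩
    1# + (ι (m ⊖ n) + ιℕ n)           ≈⟨ +-congˡ (ι-⊖+ m n) ⟩
    1# + ιℕ m                         ∎
    where
    exchange : ∀ u o y → u + (o + y) ≈ o + (u + y)
    exchange = +-CM.solve 3 (λ u o y → u +-CM.⊕ (o +-CM.⊕ y) +-CM.⊜ o +-CM.⊕ (u +-CM.⊕ y)) refl

  ι-⊖ : ∀ m n → ι (m ⊖ n) ≈ ιℕ m - ιℕ n
  ι-⊖ m n = begin
    ι (m ⊖ n)                    ≈⟨ +-identityʳ _ ⟨
    ι (m ⊖ n) + 0#               ≈⟨ +-congˡ (-‿inverseʳ (ιℕ n)) ⟨
    ι (m ⊖ n) + (ιℕ n - ιℕ n)    ≈⟨ +-assoc _ _ _ ⟨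
    (ι (m ⊖ n) + ιℕ n) - ιℕ n    ≈⟨ +-congʳ (ι-⊖+ m n) ⟩
    ιℕ m - ιℕ n                  ∎

  ι-+ : ∀ i j → ι (i ℤ.+ j) ≈ ι i + ι j
  ι-+ (+ m)    (+ n)    = ιℕ-+ m n
  ι-+ (+ m)    -[1+ n ] = ι-⊖ m (suc n)
  ι-+ -[1+ m ] (+ n)    = trans (ι-⊖ n (suc m)) (+-comm _ _)
  ι-+ -[1+ m ] -[1+ n ] = begin
    - (1# + (1# + ιℕ (m ℕ.+ n)))    ≈⟨ -‿cong (+-congˡ (+-congˡ (ιℕ-+ m n))) ⟩
    - (1# + (1# + (ιℕ m + ιℕ n)))   ≈⟨ -‿cong (regroup 1# (ιℕ m) (ιℕ n)) ⟩
    - ((1# + ιℕ m) + (1# + ιℕ n))   ≈⟨ -‿+-comm (1# + ιℕ m) (1# + ιℕ n) ⟨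
    - (1# + ιℕ m) + - (1# + ιℕ n)   ∎
    where
    regroup : ∀ o x y → o + (o + (x + y)) ≈ (o + x) + (o + y)
    regroup = +-CM.solve 3 (λ o x y → o +-CM.⊕ (o +-CM.⊕ (x +-CM.⊕ y)) +-CM.⊜ (o +-CM.⊕ x) +-CM.⊕ (o +-CM.⊕ y)) refl

  ι-neg : ∀ i → ι (ℤ.- i) ≈ - ι i
  ι-neg (+ zero)  = sym -0#≈0#
  ι-neg (+ suc n) = refl
  ι-neg -[1+ n ]  = sym (-‿involutive (ιℕ (suc n)))

  -- Multiplication goes through the sign/magnitude decomposition i = sign i ◃ ∣ i ∣.
  unit : Sign → Carrier
  unit Sign.+ = 1#
  unit Sign.- = - 1#

  unit-* : ∀ s t → unit (s Sign.* t) ≈ unit s * unit t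
  unit-* Sign.+ Sign.+ = sym (*-identityˡ 1#)
  unit-* Sign.+ Sign.- = sym (*-identityˡ (- 1#))
  unit-* Sign.- Sign.+ = sym (*-identityʳ (- 1#))
  unit-* Sign.- Sign.- = sym (trans (-1*x≈-x (- 1#)) (-‿involutive 1#))

  ι-◃ : ∀ s n → ι (s ◃ n) ≈ unit s * ιℕ n
  ι-◃ s      zero    = sym (zeroʳ (unit s))
  ι-◃ Sign.+ (suc n) = sym (*-identityˡ _)
  ι-◃ Sign.- (suc n) = sym (-1*x≈-x (ιℕ (suc n)))

  ι≈sign*abs : ∀ i → ι i ≈ unit (sign i) * ιℕ ∣ i ∣
  ι≈sign*abs i = ≡.subst (λ j → ι j ≈ unit (sign i) * ιℕ ∣ i ∣) (ℤP.◃-inverse i) (ι-◃ (sign i) ∣ i ∣)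

  ι-* : ∀ i j → ι (i ℤ.* j) ≈ ι i * ι j
  ι-* i j = begin
    ι (sign i Sign.* sign j ◃ ∣ i ∣ ℕ.* ∣ j ∣)           ≈⟨ ι-◃ (sign i Sign.* sign j) (∣ i ∣ ℕ.* ∣ j ∣) ⟩
    unit (sign i Sign.* sign j) * ιℕ (∣ i ∣ ℕ.* ∣ j ∣)     ≈⟨ *-cong (unit-* (sign i) (sign j)) (ιℕ-* ∣ i ∣ ∣ j ∣) ⟩
    (unit (sign i) * unit (sign j)) * (ιℕ ∣ i ∣ * ιℕ ∣ j ∣)   ≈⟨ interchange _ _ _ _ ⟩
    (unit (sign i) * ιℕ ∣ i ∣) * (unit (sign j) * ιℕ ∣ j ∣)   ≈⟨ *-cong (ι≈sign*abs i) (ι≈sign*abs j) ⟨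
    ι i * ι j                                           ∎
    where
    interchange : ∀ s t x y → (s * t) * (x * y) ≈ (s * x) * (t * y)
    interchange = *-CM.solve 4 (λ s t x y → (s *-CM.⊕ t) *-CM.⊕ (x *-CM.⊕ y) *-CM.⊜ (s *-CM.⊕ x) *-CM.⊕ (t *-CM.⊕ y)) refl

  ι-homomorphism : Homomorphism 0ℓ 0ℓ 0ℓ 0ℓ
  ι-homomorphism = record
    { from = record { rawRing = CommutativeRing.rawRing ℤP.+-*-commutativeRing ; isZero = isZero }
    ; to = fromCommutativeRing R (λ _ → nothing)
    ; morphism = record
      { ⟦_⟧ = ι ; +-homo = ι-+ ; *-homo = ι-* ; -‿homo = ι-neg ; 0-homo = refl ; 1-homo = +-identityʳ 1# }
    ; Zero-C⟶Zero-R = isZero-sound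
    }
    where
    isZero : ℤ → Bool
    isZero (+ zero) = true
    isZero _        = false
    isZero-sound : ∀ i → T (isZero i) → 0# ≈ ι i
    isZero-sound (+ zero) _ = refl

  module ℤSolver where
    open import Tactic.RingSolver.Core.Polynomial.Base (Homomorphism.from ι-homomorphism)
      using (Poly; κ; _⊞_; _⊠_; ⊟_; _⊡_) renaming (ι to varPoly)
    open import Tactic.RingSolver.Core.Polynomial.Semantics ι-homomorphism renaming (⟦_⟧ to ⟦_⟧ₚ)
    open import Tactic.RingSolver.Core.Polynomial.Homomorphism ι-homomorphism
    open import Algebra.Properties.Semiring.Exp.TCOptimised semiring using (^-congˡ)
    open Eval rawRing ι public

    normalise : ∀ {n} → Expr ℤ n → Poly n
    normalise (Κ c)   = κ c
    normalise (Ι i)   = varPoly i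
    normalise (p ⊕ q) = normalise p ⊞ normalise q
    normalise (p ⊗ q) = normalise p ⊠ normalise q
    normalise (⊝ p)   = ⊟ normalise p
    normalise (p ⊛ k) = normalise p ⊡ k

    ⟦_⇓⟧ : ∀ {n} → Expr ℤ n → Vec Carrier n → Carrier
    ⟦ p ⇓⟧ = ⟦ normalise p ⟧ₚ

    normalise-correct : ∀ {n} (p : Expr ℤ n) ρ → ⟦ p ⇓⟧ ρ ≈ ⟦ p ⟧ ρ
    normalise-correct (Κ c)   ρ = κ-hom c ρ
    normalise-correct (Ι i)   ρ = ι-hom i ρ
    normalise-correct (p ⊕ q) ρ = trans (⊞-hom (normalise p) (normalise q) ρ) (+-cong (normalise-correct p ρ) (normalise-correct q ρ))
    normalise-correct (p ⊗ q) ρ = trans (⊠-hom (normalise p) (normalise q) ρ) (*-cong (normalise-correct p ρ) (normalise-correct q ρ))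
    normalise-correct (⊝ p)   ρ = trans (⊟-hom (normalise p) ρ) (-‿cong (normalise-correct p ρ))
    normalise-correct (p ⊛ k) ρ = trans (⊡-hom (normalise p) k ρ) (^-congˡ k (normalise-correct p ρ))

    open import Relation.Binary.Reflection setoid Ι ⟦_⟧ ⟦_⇓⟧ normalise-correct public using (prove)

-- The polynomials of the argument, as solver expressions over any set of
-- variables, so that one polynomial can be evaluated in several environments.
module Polynomials where

  open import Data.Nat as ℕ using (ℕ; zero; suc)
  open import Data.Integer as ℤ using (ℤ; +_)
  open import Data.Fin as Fin using (Fin)
  open import Relation.Nullary using (yes; no)

  open import Tactic.RingSolver.Core.Expression public using (Expr; Κ; Ι; _⊕_; _⊗_; ⊝_; _⊛_)

  Term : ℕ → Set
  Term = Expr ℤ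

  infixr 8 _^_
  infixl 6 _−_

  -- Powers unfold as in Defs._^^_, so that evaluations agree definitionally.
  _^_ : ∀ {n} → Term n → ℕ → Term n
  e ^ zero  = Κ (+ 1)
  e ^ suc k = e ⊗ e ^ k

  _−_ : ∀ {n} → Term n → Term n → Term n
  p − q = p ⊕ ⊝ q

  module _ {n : ℕ} where

    Fpoly Gpoly : (α β : Term n) → Term n → Term n → Term n
    Fpoly α β X W = X ^ 4 ⊕ α ⊗ X ^ 2 ⊗ W ^ 2 ⊕ β ⊗ X ⊗ W ^ 3
    Gpoly A κ Z W = Z ^ 3 ⊕ A ⊗ Z ⊗ W ^ 2 ⊕ κ ⊗ W ^ 3

    Kpoly : (η A κ α β Z X Y W : Term n) → Term n
    Kpoly η A κ α β Z X Y W =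
      η ⊗ W ⊗ Gpoly A κ Z W ⊕ Κ (ℤ.- + 2) ⊗ (Fpoly α β X W ⊕ Κ (ℤ.- + 1) ⊗ Fpoly α β Y W)

    -- The homogenised derivative W³f′(X/W) = 4X³ + 2αXW² + βW³ of f(x) = x⁴ + αx² + βx.
    fCrit : (α β X W : Term n) → Term n
    fCrit α β X W = Κ (+ 4) ⊗ X ^ 3 ⊕ Κ (+ 2) ⊗ α ⊗ X ⊗ W ^ 2 ⊕ β ⊗ W ^ 3

    -- The divided difference (fCrit X − fCrit Y)/(X − Y).
    pairQuadratic : (α X Y W : Term n) → Term n
    pairQuadratic α X Y W = Κ (+ 4) ⊗ (X ⊗ X ⊕ X ⊗ Y ⊕ Y ⊗ Y) ⊕ Κ (+ 2) ⊗ α ⊗ W ^ 2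

    -- 4s³ + 2αsW² − βW³: −s is a root of fCrit exactly when s is a root of this cubic.
    cubic : (α β s W : Term n) → Term n
    cubic α β s W = Κ (+ 4) ⊗ s ^ 3 ⊕ Κ (+ 2) ⊗ α ⊗ s ⊗ W ^ 2 − β ⊗ W ^ 3

    quadratic : (s W e₀ e₁ e₂ : Term n) → Term n
    quadratic s W e₀ e₁ e₂ = e₀ ⊗ W ^ 2 ⊕ e₁ ⊗ s ⊗ W ⊕ e₂ ⊗ s ⊗ s

    -- The resultant of `cubic` and `quadratic` in s: the determinant of the matrix
    -- whose rows are (1, s, s²)·quadratic reduced modulo the cubic (rows scaled by 4),
    -- expanded along its first column.
    resultant : (α β e₀ e₁ e₂ : Term n) → Term n
    resultant α β e₀ e₁ e₂ = e₀ ⊗ a₀₀ ⊕ m₁₀ ⊗ a₀₁ ⊕ m₂₀ ⊗ a₀₂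
      where
      m₁₀ m₁₁ m₁₂ m₂₀ m₂₁ m₂₂ a₀₀ a₀₁ a₀₂ : Term n
      m₁₀ = e₂ ⊗ β
      m₁₁ = Κ (+ 4) ⊗ e₀ − Κ (+ 2) ⊗ α ⊗ e₂
      m₁₂ = Κ (+ 4) ⊗ e₁
      m₂₀ = Κ (+ 4) ⊗ e₁ ⊗ β
      m₂₁ = Κ (+ 4) ⊗ e₂ ⊗ β − Κ (+ 8) ⊗ α ⊗ e₁
      m₂₂ = Κ (+ 4) ⊗ m₁₁
      a₀₀ = m₁₁ ⊗ m₂₂ − m₁₂ ⊗ m₂₁
      a₀₁ = ⊝ (e₁ ⊗ m₂₂ − e₂ ⊗ m₂₁)
      a₀₂ = e₁ ⊗ m₁₂ − e₂ ⊗ m₁₁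

    -- η² = A − 2α expresses A = h₁²h₂²ρ² + 2a.
    Hpoly : (A α : Term n) → Term n
    Hpoly A α = A − Κ (+ 2) ⊗ α

    -- Abbreviations M(A), P(A) which keep the eliminant for X ≠ Y small.
    Mpoly : (A α β : Term n) → Term n
    Mpoly A α β = Κ (+ 16) ⊗ Hpoly A α ⊗ (Κ (+ 27) ⊗ β ⊗ β ⊕ A ^ 3)

    Ppoly : (A α β M : Term n) → Term n
    Ppoly A α β M = Κ (+ 54) ⊗ M − Κ (+ 46656) ⊗ Hpoly A α ⊗ β ⊗ β

    equalRootsPoly : (A β : Term n) → Term n
    equalRootsPoly A β = A ^ 3 ⊕ Κ (+ 27) ⊗ β ⊗ β

    -- Coefficients of the eliminant free of η and X − Y, reduced modulo the cubic
    -- in s = X + Y (see `reduce-mod-cubic`).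
    reducedCoeff₀ reducedCoeff₁ reducedCoeff₂ : (α β M P : Term n) → Term n
    reducedCoeff₀ α β M P =
      Κ (+ 4) ⊗ M ^ 2 − Κ (+ 108) ⊗ α ⊗ β ^ 2 ⊗ P ⊕ Κ (+ 2480058) ⊗ α ^ 2 ⊗ β ^ 4 ⊕ Κ (+ 26244) ⊗ α ^ 5 ⊗ β ^ 2
    reducedCoeff₁ α β M P =
      Κ (+ 531441) ⊗ β ^ 5 − Κ (+ 36) ⊗ α ^ 2 ⊗ β ⊗ P ⊕ Κ (+ 787320) ⊗ α ^ 3 ⊗ β ^ 3 − Κ (+ 49572) ⊗ α ^ 6 ⊗ β
    reducedCoeff₂ α β M P =
      Κ (+ 3188646) ⊗ α ⊗ β ^ 4 − Κ (+ 108) ⊗ β ^ 2 ⊗ P − Κ (+ 8) ⊗ α ^ 3 ⊗ P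
      ⊕ Κ (+ 393660) ⊗ α ^ 4 ⊗ β ^ 2 − Κ (+ 5832) ⊗ α ^ 7

    resultantPoly : (α β M P : Term n) → Term n
    resultantPoly α β M P =
      resultant α β (reducedCoeff₀ α β M P) (reducedCoeff₁ α β M P) (reducedCoeff₂ α β M P)

  ∂ : ∀ {n} → Fin 4 → Term n → Term n
  ∂ i (Κ _)   = Κ (+ 0)
  ∂ i (Ι j) with Fin.toℕ i ℕ.≟ Fin.toℕ j
  ... | yes _ = Κ (+ 1)
  ... | no _  = Κ (+ 0)
  ∂ i (p ⊕ q) = ∂ i p ⊕ ∂ i q
  ∂ i (p ⊗ q) = ∂ i p ⊗ q ⊕ p ⊗ ∂ i q
  ∂ i (⊝ p)   = ⊝ ∂ i p
  ∂ i (p ⊛ zero)  = Κ (+ 0)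
  ∂ i (p ⊛ suc k) = Κ (+ suc k) ⊗ p ⊛ k ⊗ ∂ i p

module FieldAlgebra (F : AlgebraicClosureOfℚ 0ℓ 0ℓ) where

  open import Data.Nat as ℕ using (ℕ; zero; suc)
  open import Data.Integer as ℤ using (ℤ; +_; -[1+_])
  open import Data.Fin using (#_)
  open import Data.Vec using (Vec; []; _∷_)
  open import Data.List using (List; []; _∷_)
  open import Data.List.Relation.Unary.All using (All; []; _∷_)
  open import Data.Product using (_×_; _,_; proj₂)
  open import Data.Sum using (_⊎_; inj₁; inj₂)
  open import Data.Empty using (⊥-elim)
  open import Relation.Nullary using (¬_; yes; no)
  open import Relation.Binary.PropositionalEquality as ≡ using (_≡_)

  open AlgebraicClosureOfℚ F using (R; _≟_; inverse; char0)
  open CommutativeRing R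
  open IntegerCoefficients R
  open ℤSolver using (⟦_⟧; ⟦_⇓⟧; prove)
  open Polynomials
  open import Relation.Binary.Reasoning.Setoid setoid

  zero-product : ∀ x y → x * y ≈ 0# → x ≈ 0# ⊎ y ≈ 0#
  zero-product x y xy≈0 with x ≟ 0#
  ... | yes x≈0 = inj₁ x≈0
  ... | no x≉0 with inverse x x≉0
  ... | x⁻¹ , xx⁻¹≈1 = inj₂ (begin
    y                ≈⟨ *-identityˡ y ⟨
    1# * y           ≈⟨ *-congʳ xx⁻¹≈1 ⟨
    (x * x⁻¹) * y    ≈⟨ *-congʳ (*-comm x x⁻¹) ⟩
    (x⁻¹ * x) * y    ≈⟨ *-assoc x⁻¹ x y ⟩
    x⁻¹ * (x * y)    ≈⟨ *-congˡ xy≈0 ⟩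
    x⁻¹ * 0#         ≈⟨ zeroʳ x⁻¹ ⟩
    0#               ∎)

  nonzero-* : ∀ {x y} → ¬ x ≈ 0# → ¬ y ≈ 0# → ¬ x * y ≈ 0#
  nonzero-* x≉0 y≉0 xy≈0 with zero-product _ _ xy≈0
  ... | inj₁ x≈0 = x≉0 x≈0
  ... | inj₂ y≈0 = y≉0 y≈0

  cancel-nonzero : ∀ {c x} → ¬ c ≈ 0# → c * x ≈ 0# → x ≈ 0#
  cancel-nonzero c≉0 cx≈0 with zero-product _ _ cx≈0
  ... | inj₁ c≈0 = ⊥-elim (c≉0 c≈0)
  ... | inj₂ x≈0 = x≈0

  ι-nonzero : ∀ n → .{{ℕ.NonZero n}} → ¬ ι (+ n) ≈ 0#
  ι-nonzero (suc n) = char0 n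

  ι≈0⇒≡0 : ∀ k → ι k ≈ 0# → k ≡ + 0
  ι≈0⇒≡0 (+ zero)   _    = ≡.refl
  ι≈0⇒≡0 (+ suc n)  ιk≈0 = ⊥-elim (char0 n ιk≈0)
  ι≈0⇒≡0 -[1+ n ]   ιk≈0 = ⊥-elim (char0 n (trans (ι-neg -[1+ n ]) (trans (-‿cong ιk≈0) -0#≈0#)))
    where open import Algebra.Properties.Ring ring using (-0#≈0#)

  -- Vanishing of polynomial expressions at a valuation ρ of their variables,
  -- and the basic way to prove it: an identity  lhs = Σ cᵢ·hᵢ  checked by the
  -- ring solver shows that lhs vanishes wherever all the hᵢ do.  The lemmas
  -- below fix a few named variables and are applied by choosing ρ.
  module Certificates {n : ℕ} (ρ : Vec Carrier n) where

    Vanishes : Term n → Set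
    Vanishes e = ⟦ e ⟧ ρ ≈ 0#

    combination : List (Term n × Term n) → Term n
    combination []             = Κ (+ 0)
    combination ((c , h) ∷ cs) = c ⊗ h ⊕ combination cs

    combination-vanishes : ∀ cs → All (λ ch → Vanishes (proj₂ ch)) cs → Vanishes (combination cs)
    combination-vanishes []             []        = refl
    combination-vanishes ((c , h) ∷ cs) (h≈0 ∷ hs) = begin
      ⟦ c ⟧ ρ * ⟦ h ⟧ ρ + ⟦ combination cs ⟧ ρ ≈⟨ +-cong (*-congˡ h≈0) (combination-vanishes cs hs) ⟩
      ⟦ c ⟧ ρ * 0# + 0#                        ≈⟨ +-identityʳ _ ⟩
      ⟦ c ⟧ ρ * 0#                             ≈⟨ zeroʳ _ ⟩
      0#                                       ∎

    derive : ∀ lhs cs → ⟦ lhs ⇓⟧ ρ ≈ ⟦ combination cs ⇓⟧ ρ →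
             All (λ ch → Vanishes (proj₂ ch)) cs → Vanishes lhs
    derive lhs cs identity hs = trans (prove ρ lhs (combination cs) identity) (combination-vanishes cs hs)

    cancel : ∀ c e → ¬ Vanishes c → Vanishes (c ⊗ e) → Vanishes e
    cancel c e = cancel-nonzero

    nonzero-const : ∀ k → ¬ Vanishes (Κ (+ suc k))
    nonzero-const = char0

    nonzero-^ : ∀ e → ¬ Vanishes e → ∀ k → ¬ Vanishes (e ^ k)
    nonzero-^ e e≉0 zero    = nonzero-const 0
    nonzero-^ e e≉0 (suc k) = nonzero-* e≉0 (nonzero-^ e e≉0 k)

    vanishing-power : ∀ e k → Vanishes (e ^ k) → Vanishes e
    vanishing-power e zero    1≈0 = ⊥-elim (nonzero-const 0 1≈0)
    vanishing-power e (suc k) eᵏ⁺¹≈0 with zero-product _ _ eᵏ⁺¹≈0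
    ... | inj₁ e≈0  = e≈0
    ... | inj₂ eᵏ≈0 = vanishing-power e k eᵏ≈0

  module CriticalAtInfinity (ρ : Vec Carrier 4) where
    open Certificates ρ
    α β T W : Term 4
    α = Ι (# 0)
    β = Ι (# 1)
    T = Ι (# 2)
    W = Ι (# 3)

    -- 4T³ = fCrit − W·(2αTW + βW²)
    critical-at-infinity : Vanishes (fCrit α β T W) → Vanishes W → Vanishes T
    critical-at-infinity crit W≈0 =
      vanishing-power T 3 (cancel (Κ (+ 4)) (T ^ 3) (nonzero-const 3)
        (derive (Κ (+ 4) ⊗ T ^ 3) ((Κ (+ 1) , fCrit α β T W) ∷ (⊝ (Κ (+ 2) ⊗ α ⊗ T ⊗ W ⊕ β ⊗ W ^ 2) , W) ∷ [])
          refl (crit ∷ W≈0 ∷ [])))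

  -- Two distinct critical points X ≠ Y: their sum s = X + Y satisfies the
  -- cubic 4s³ + 2αsW² − βW³ (−s is the third root).
  module DistinctCriticalPoints (ρ : Vec Carrier 5) where
    open Certificates ρ
    α β X Y W : Term 5
    α = Ι (# 0)
    β = Ι (# 1)
    X = Ι (# 2)
    Y = Ι (# 3)
    W = Ι (# 4)

    q : Term 5
    q = pairQuadratic α X Y W

    -- (X − Y)·q = fCrit X − fCrit Y
    pair-quadratic : Vanishes (fCrit α β X W) → Vanishes (fCrit α β Y W) → ¬ Vanishes (X − Y) → Vanishes q
    pair-quadratic critX critY X≉Y = cancel (X − Y) q X≉Y
      (derive ((X − Y) ⊗ q) ((Κ (+ 1) , fCrit α β X W) ∷ (Κ (ℤ.- + 1) , fCrit α β Y W) ∷ []) refl (critX ∷ critY ∷ []))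

    -- 2·cubic(X + Y) = 3(X + Y)·q − fCrit X − fCrit Y
    sum-root : Vanishes (fCrit α β X W) → Vanishes (fCrit α β Y W) → Vanishes q → Vanishes (cubic α β (X ⊕ Y) W)
    sum-root critX critY q≈0 = cancel (Κ (+ 2)) (cubic α β (X ⊕ Y) W) (nonzero-const 1)
      (derive (Κ (+ 2) ⊗ cubic α β (X ⊕ Y) W)
        ((Κ (ℤ.- + 1) , fCrit α β X W) ∷ (Κ (ℤ.- + 1) , fCrit α β Y W) ∷ (Κ (+ 3) ⊗ (X ⊕ Y) , q) ∷ []) refl
        (critX ∷ critY ∷ q≈0 ∷ []))

  module Resultant (ρ : Vec Carrier 7) where
    open Certificates ρ
    s W α β e₀ e₁ e₂ : Term 7
    s  = Ι (# 0)
    W  = Ι (# 1)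
    α  = Ι (# 2)
    β  = Ι (# 3)
    e₀ = Ι (# 4)
    e₁ = Ι (# 5)
    e₂ = Ι (# 6)

    -- W⁴·resultant = c_q·quadratic + c_C·cubic
    common-root : ¬ Vanishes W → Vanishes (cubic α β s W) → Vanishes (quadratic s W e₀ e₁ e₂) →
                  Vanishes (resultant α β e₀ e₁ e₂)
    common-root W≉0 cubic≈0 quadratic≈0 = cancel (W ^ 4) (resultant α β e₀ e₁ e₂) (nonzero-^ W W≉0 4)
      (derive (W ^ 4 ⊗ resultant α β e₀ e₁ e₂) ((c_q , quadratic s W e₀ e₁ e₂) ∷ (c_C , cubic α β s W) ∷ []) refl
        (quadratic≈0 ∷ cubic≈0 ∷ []))
      where
      c_q c_C : Term 7
      c_q = Κ (+ 16) ⊗ W ^ 2 ⊗ (Κ (+ 4) ⊗ e₀ ⊗ e₀ − β ⊗ e₁ ⊗ e₂ ⊕ Κ (+ 2) ⊗ α ⊗ e₁ ⊗ e₁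
                                 − Κ (+ 4) ⊗ α ⊗ e₀ ⊗ e₂ ⊕ α ⊗ α ⊗ e₂ ⊗ e₂)
          ⊕ Κ (+ 16) ⊗ s ⊗ W ⊗ (β ⊗ e₂ ⊗ e₂ − Κ (+ 4) ⊗ e₀ ⊗ e₁)
          ⊕ Κ (+ 32) ⊗ s ⊗ s ⊗ (Κ (+ 2) ⊗ e₁ ⊗ e₁ − Κ (+ 2) ⊗ e₀ ⊗ e₂ ⊕ α ⊗ e₂ ⊗ e₂)
      c_C = Κ (+ 4) ⊗ W ⊗ (Κ (+ 8) ⊗ e₀ ⊗ e₁ ⊗ e₂ − Κ (+ 4) ⊗ e₁ ^ 3 − β ⊗ e₂ ^ 3 − Κ (+ 2) ⊗ α ⊗ e₁ ⊗ e₂ ⊗ e₂)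
          ⊕ Κ (+ 8) ⊗ s ⊗ e₂ ⊗ (Κ (+ 2) ⊗ e₀ ⊗ e₂ − Κ (+ 2) ⊗ e₁ ⊗ e₁ − α ⊗ e₂ ⊗ e₂)

module SingularPoints (F : AlgebraicClosureOfℚ 0ℓ 0ℓ) where

  open import Data.Nat as ℕ using (ℕ)
  open import Data.Integer as ℤ using (ℤ; +_)
  open import Data.Fin using (Fin; #_)
  open import Data.Vec using (Vec; []; _∷_)
  open import Data.List using ([]; _∷_)
  open import Data.List.Relation.Unary.All using ([]; _∷_)
  open import Data.Product using (_,_; ∃)
  open import Data.Sum using (_⊎_; inj₁; inj₂)
  open import Data.Empty using (⊥-elim)
  open import Relation.Nullary using (¬_; yes; no; Dec)
  open import Relation.Binary.PropositionalEquality as ≡ using (_≡_)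
  import Defs as D

  open AlgebraicClosureOfℚ F using (R; _≟_)
  open CommutativeRing R
  open IntegerCoefficients R
  open ℤSolver using (⟦_⟧)
  open Polynomials
  open FieldAlgebra F

  -- The analysis of a point x = (Z, X, Y, W) in eleven variables: the four
  -- coordinates, the parameters η = h₁h₂ρ, A, κ = h₂c, α = a, β = b, and the
  -- two abbreviations M, P.
  module AtPoint (a b : ℤ) (h₁ h₂ ρ : ℕ) (c : ℤ) (x : Fin 4 → Carrier) (Mval Pval : Carrier) where

    env : Vec Carrier 11
    env = x (# 0) ∷ x (# 1) ∷ x (# 2) ∷ x (# 3) ∷ ι (+ (h₁ ℕ.* h₂ ℕ.* ρ)) ∷ ι (D.Aconst a h₁ h₂ ρ)
        ∷ ι (+ h₂ ℤ.* c) ∷ ι a ∷ ι b ∷ Mval ∷ Pval ∷ []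

    open Certificates env

    Z X Y W η A κ α β M P : Term 11
    Z = Ι (# 0)
    X = Ι (# 1)
    Y = Ι (# 2)
    W = Ι (# 3)
    η = Ι (# 4)
    A = Ι (# 5)
    κ = Ι (# 6)
    α = Ι (# 7)
    β = Ι (# 8)
    M = Ι (# 9)
    P = Ι (# 10)

    K : Term 11
    K = Kpoly η A κ α β Z X Y W

    K-agrees : D.⟦_⟧ R (D.Kform a b h₁ h₂ ρ c) x ≡ ⟦ K ⟧ env
    K-agrees = ≡.refl

    ∂K-agrees : ∀ i → D.⟦_⟧ R (D.∂ i (D.Kform a b h₁ h₂ ρ c)) x ≡ ⟦ ∂ i K ⟧ env
    ∂K-agrees Fin.zero                               = ≡.refl
    ∂K-agrees (Fin.suc Fin.zero)                     = ≡.refl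
    ∂K-agrees (Fin.suc (Fin.suc Fin.zero))           = ≡.refl
    ∂K-agrees (Fin.suc (Fin.suc (Fin.suc Fin.zero))) = ≡.refl

    -- Polynomials met along the elimination: critZ is the cofactor of ηW in ∂K/∂Z;
    -- critDiff equals 4(W⁴f(X/W) − W⁴f(Y/W)) at critical points X, Y; linearZ is
    -- linear in Z and eliminantZ is free of Z.
    critZ critDiff shifted linearZ eliminantZ κ-relation : Term 11
    critZ      = Κ (+ 3) ⊗ Z ⊗ Z ⊕ A ⊗ W ^ 2
    critDiff   = Κ (+ 2) ⊗ α ⊗ (X ⊗ X − Y ⊗ Y) ⊗ W ^ 2 ⊕ Κ (+ 3) ⊗ β ⊗ (X − Y) ⊗ W ^ 3
    shifted    = critDiff − Κ (+ 4) ⊗ η ⊗ β ⊗ W ^ 4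
    linearZ    = Κ (+ 4) ⊗ η ⊗ A ⊗ Z ⊗ W ^ 3 − Κ (+ 3) ⊗ shifted
    eliminantZ = Κ (+ 27) ⊗ shifted ^ 2 ⊕ Κ (+ 16) ⊗ η ^ 2 ⊗ A ^ 3 ⊗ W ^ 8
    κ-relation = κ − Κ (+ 2) ⊗ β

    critX critY : Term 11
    critX = fCrit α β X W
    critY = fCrit α β Y W

    -- ∂K/∂Z = η·W·(3Z² + AW²)
    from-∂Z : Vanishes (∂ (# 0) K) → ¬ Vanishes η → Vanishes (W ⊗ critZ)
    from-∂Z ∂Z≈0 η≉0 = cancel η (W ⊗ critZ) η≉0
      (derive (η ⊗ (W ⊗ critZ)) ((Κ (+ 1) , ∂ (# 0) K) ∷ []) refl (∂Z≈0 ∷ []))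

    -- ∂K/∂X = −2·fCrit(X)  and  ∂K/∂Y = 2·fCrit(Y)
    from-∂X : Vanishes (∂ (# 1) K) → Vanishes critX
    from-∂X ∂X≈0 = cancel (Κ (+ 2)) critX (nonzero-const 1)
      (derive (Κ (+ 2) ⊗ critX) ((Κ (ℤ.- + 1) , ∂ (# 1) K) ∷ []) refl (∂X≈0 ∷ []))

    from-∂Y : Vanishes (∂ (# 2) K) → Vanishes critY
    from-∂Y ∂Y≈0 = cancel (Κ (+ 2)) critY (nonzero-const 1)
      (derive (Κ (+ 2) ⊗ critY) ((Κ (+ 1) , ∂ (# 2) K) ∷ []) refl (∂Y≈0 ∷ []))

    -- At W = 0:  η·Z³ = ∂K/∂W + W·(4α(X² − Y²) + 6βW(X − Y) − ηW(3AZ + 4κW)).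
    from-∂W-at-infinity : Vanishes (∂ (# 3) K) → ¬ Vanishes η → Vanishes W → Vanishes Z
    from-∂W-at-infinity ∂W≈0 η≉0 W≈0 = vanishing-power Z 3 (cancel η (Z ^ 3) η≉0
      (derive (η ⊗ Z ^ 3) ((Κ (+ 1) , ∂ (# 3) K) ∷ (rest , W) ∷ []) refl (∂W≈0 ∷ W≈0 ∷ [])))
      where
      rest : Term 11
      rest = Κ (+ 4) ⊗ α ⊗ (X ⊗ X − Y ⊗ Y) ⊕ Κ (+ 6) ⊗ β ⊗ W ⊗ (X − Y) − η ⊗ W ⊗ (Κ (+ 3) ⊗ A ⊗ Z ⊕ Κ (+ 4) ⊗ κ ⊗ W)

    -- An Euler-type combination, linear in Z once 3Z² = −AW²:
    -- linearZ = 6K − 2ηZW·critZ + 3X·critX − 3Y·critY − 6ηW⁴·(κ − 2β).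
    linear-in-Z : Vanishes K → Vanishes critZ → Vanishes critX → Vanishes critY → Vanishes κ-relation →
                  Vanishes linearZ
    linear-in-Z K≈0 critZ≈0 critX≈0 critY≈0 κ≈2β = derive linearZ
      ((Κ (+ 6) , K) ∷ (Κ (ℤ.- + 2) ⊗ η ⊗ Z ⊗ W , critZ) ∷ (Κ (+ 3) ⊗ X , critX) ∷ (Κ (ℤ.- + 3) ⊗ Y , critY)
        ∷ (Κ (ℤ.- + 6) ⊗ η ⊗ W ^ 4 , κ-relation) ∷ [])
      refl (K≈0 ∷ critZ≈0 ∷ critX≈0 ∷ critY≈0 ∷ κ≈2β ∷ [])

    -- Squaring 3·shifted = 4ηAZW³ − linearZ and using 3Z² = critZ − AW² removes Z:
    -- eliminantZ = 16η²A²W⁶·critZ + 3(linearZ − 8ηAZW³)·linearZ.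
    eliminate-Z : Vanishes critZ → Vanishes linearZ → Vanishes eliminantZ
    eliminate-Z critZ≈0 linearZ≈0 = derive eliminantZ
      ((Κ (+ 16) ⊗ η ^ 2 ⊗ A ^ 2 ⊗ W ^ 6 , critZ) ∷ (Κ (+ 3) ⊗ (linearZ − Κ (+ 8) ⊗ η ⊗ A ⊗ Z ⊗ W ^ 3) , linearZ) ∷ [])
      refl (critZ≈0 ∷ linearZ≈0 ∷ [])

    s δ m : Term 11
    s = X ⊕ Y
    δ = X − Y
    m = Κ (+ 2) ⊗ α ⊗ s ⊕ Κ (+ 3) ⊗ β ⊗ W

    -- For X = Y:  critDiff = δ·m·W² vanishes, and
    -- 16η²W⁸·(A³ + 27β²) = eliminantZ + 27mW²(8ηβW⁴ − δmW²)·δ.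
    equal-roots : Vanishes eliminantZ → Vanishes δ → ¬ Vanishes η → ¬ Vanishes W → Vanishes (equalRootsPoly A β)
    equal-roots elim≈0 δ≈0 η≉0 W≉0 = cancel factor (equalRootsPoly A β) factor≉0
      (derive (factor ⊗ equalRootsPoly A β)
        ((Κ (+ 1) , eliminantZ) ∷ (Κ (+ 27) ⊗ m ⊗ W ^ 2 ⊗ (Κ (+ 8) ⊗ η ⊗ β ⊗ W ^ 4 − δ ⊗ m ⊗ W ^ 2) , δ) ∷ [])
        refl (elim≈0 ∷ δ≈0 ∷ []))
      where
      factor : Term 11
      factor = Κ (+ 16) ⊗ η ^ 2 ⊗ W ^ 8
      factor≉0 : ¬ Vanishes factor
      factor≉0 = nonzero-* (nonzero-* (nonzero-const 15) (nonzero-^ η η≉0 2)) (nonzero-^ W W≉0 8)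

    -- For X ≠ Y the parameters η and δ are eliminated in turn from the
    -- eliminant  E(v) = 729v² + P·W⁸·v + M²W¹⁶.
    E : Term 11 → Term 11
    E v = Κ (+ 729) ⊗ v ^ 2 ⊕ P ⊗ W ^ 8 ⊗ v ⊕ M ^ 2 ⊗ W ^ 16

    M-definition P-definition η-definition q T : Term 11
    M-definition = M − Mpoly A α β
    P-definition = P − Ppoly A α β M
    η-definition = η ^ 2 − Hpoly A α
    q = pairQuadratic α X Y W
    -- δ² = q − 3s² − 2αW², so δ²·m²W⁴ ≡ T modulo q
    T = (⊝ (Κ (+ 3) ⊗ s ^ 2) − Κ (+ 2) ⊗ α ⊗ W ^ 2) ⊗ W ^ 4 ⊗ m ^ 2

    -- eliminantZ = N − 216ηβW⁴·critDiff + W⁸·(η-part), with N = 27 critDiff² + MW⁸;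
    -- multiplying by N + 216ηβW⁴·critDiff and using η² = H yields E(critDiff²).
    eliminate-η : Vanishes eliminantZ → Vanishes M-definition → Vanishes P-definition → Vanishes η-definition →
                  Vanishes (E (critDiff ^ 2))
    eliminate-η elim≈0 M≈ P≈ η≈ = derive (E (critDiff ^ 2))
      ((N⁺ , eliminantZ) ∷ (N⁺ ⊗ W ^ 8 , M-definition)
        ∷ (W ^ 8 ⊗ (Κ (+ 46656) ⊗ β ^ 2 ⊗ critDiff ^ 2 − N⁺ ⊗ (Κ (+ 432) ⊗ β ^ 2 ⊕ Κ (+ 16) ⊗ A ^ 3)) , η-definition)
        ∷ (W ^ 8 ⊗ critDiff ^ 2 , P-definition) ∷ [])
      refl (elim≈0 ∷ M≈ ∷ η≈ ∷ P≈ ∷ [])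
      where
      N⁺ : Term 11
      N⁺ = Κ (+ 27) ⊗ critDiff ^ 2 ⊕ M ⊗ W ^ 8 ⊕ Κ (+ 216) ⊗ η ⊗ β ⊗ W ^ 4 ⊗ critDiff

    -- critDiff² − T = W⁴m²·q, hence E(critDiff²) − E(T) = (729(critDiff² + T) + PW⁸)·W⁴m²·q.
    eliminate-δ : Vanishes (E (critDiff ^ 2)) → Vanishes q → Vanishes (E T)
    eliminate-δ E≈0 q≈0 = derive (E T)
      ((Κ (+ 1) , E (critDiff ^ 2)) ∷ (⊝ ((Κ (+ 729) ⊗ (critDiff ^ 2 ⊕ T) ⊕ P ⊗ W ^ 8) ⊗ W ^ 4 ⊗ m ^ 2) , q) ∷ [])
      refl (E≈0 ∷ q≈0 ∷ [])

    sCubic reduced : Term 11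
    sCubic  = cubic α β s W
    reduced = quadratic s W (reducedCoeff₀ α β M P) (reducedCoeff₁ α β M P) (reducedCoeff₂ α β M P)

    -- With D = 2α³ + 27β²,
    --   16·T  = W⁶·t + k·cubic,   t = −16Ds² − 144α²βsW − 432αβ²W²,  k = −48αW⁴(αs + 3βW),
    --   16·t² = r + q₂·cubic,     q₂ = 32D(32Ds + 576α²βW),  r of degree 2 in s,
    --   1024W²·reduced = 729r + 256PW²t + 4096M²W⁴;
    -- together  4096·E(T) = 1024W¹⁴·reduced + cubic·(729W¹²q₂ + 16(729k(2W⁶t + k·cubic) + 16PW⁸k)).
    reduce-mod-cubic : Vanishes (E T) → Vanishes sCubic → ¬ Vanishes W → Vanishes reduced
    reduce-mod-cubic E≈0 cubic≈0 W≉0 = cancel (W ^ 14) reduced (nonzero-^ W W≉0 14)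
      (cancel (Κ (+ 1024)) (W ^ 14 ⊗ reduced) (nonzero-const 1023)
        (derive (Κ (+ 1024) ⊗ (W ^ 14 ⊗ reduced))
          ((Κ (+ 4096) , E T) ∷ (⊝ quotient , sCubic) ∷ []) refl (E≈0 ∷ cubic≈0 ∷ [])))
      where
      D t k q₂ quotient : Term 11
      D = Κ (+ 2) ⊗ α ^ 3 ⊕ Κ (+ 27) ⊗ β ^ 2
      t = ⊝ (Κ (+ 16) ⊗ D ⊗ s ^ 2) − Κ (+ 144) ⊗ α ^ 2 ⊗ β ⊗ s ⊗ W − Κ (+ 432) ⊗ α ⊗ β ^ 2 ⊗ W ^ 2
      k = ⊝ (Κ (+ 48) ⊗ α ⊗ W ^ 4 ⊗ (α ⊗ s ⊕ Κ (+ 3) ⊗ β ⊗ W))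
      q₂ = Κ (+ 32) ⊗ D ⊗ (Κ (+ 32) ⊗ D ⊗ s ⊕ Κ (+ 576) ⊗ α ^ 2 ⊗ β ⊗ W)
      quotient = Κ (+ 729) ⊗ W ^ 12 ⊗ q₂ ⊕ Κ (+ 16) ⊗ (Κ (+ 729) ⊗ k ⊗ (Κ (+ 2) ⊗ W ^ 6 ⊗ t ⊕ k ⊗ sCubic) ⊕ Κ (+ 16) ⊗ P ⊗ W ^ 8 ⊗ k)

    open import Algebra.Properties.Ring ring using (x∙y⁻¹≈ε⇒x≈y; x≈y⇒x∙y⁻¹≈ε)

    -- Affine points: the two critical points X, Y of the quartic either coincide
    -- or are distinct roots, and each case yields one eliminant.  (The case
    -- splits go through helpers on Dec: a `with` would normalise the large goal.)
    affine⇒eliminant : ¬ Vanishes W → ¬ Vanishes η → Vanishes critX → Vanishes critY → Vanishes eliminantZ →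
      Vanishes M-definition → Vanishes P-definition → Vanishes η-definition →
      Vanishes (equalRootsPoly A β) ⊎ Vanishes (resultantPoly α β M P)
    affine⇒eliminant W≉0 η≉0 critX≈0 critY≈0 elim≈0 M≈ P≈ η≈ = by-XY (x (# 1) ≟ x (# 2))
      where
      by-XY : Dec (x (# 1) ≈ x (# 2)) → Vanishes (equalRootsPoly A β) ⊎ Vanishes (resultantPoly α β M P)
      by-XY (yes X≈Y) = inj₁ (equal-roots elim≈0 (x≈y⇒x∙y⁻¹≈ε X≈Y) η≉0 W≉0)
      by-XY (no X≉Y)  = inj₂ (Resultant.common-root
          (⟦ s ⟧ env ∷ x (# 3) ∷ ι a ∷ ι b
            ∷ ⟦ reducedCoeff₀ α β M P ⟧ env ∷ ⟦ reducedCoeff₁ α β M P ⟧ env ∷ ⟦ reducedCoeff₂ α β M P ⟧ env ∷ [])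
          W≉0 cubic≈0 (reduce-mod-cubic (eliminate-δ (eliminate-η elim≈0 M≈ P≈ η≈) q≈0) cubic≈0 W≉0))
        where
        open DistinctCriticalPoints (ι a ∷ ι b ∷ x (# 1) ∷ x (# 2) ∷ x (# 3) ∷ []) using (pair-quadratic; sum-root)
        q≈0 : Vanishes q
        q≈0 = pair-quadratic critX≈0 critY≈0 (λ δ≈0 → X≉Y (x∙y⁻¹≈ε⇒x≈y _ _ δ≈0))
        cubic≈0 : Vanishes sCubic
        cubic≈0 = sum-root critX≈0 critY≈0 q≈0

    singular⇒eliminant : (∃ λ i → ¬ x i ≈ 0#) → Vanishes K → (∀ i → Vanishes (∂ i K)) →
      ¬ Vanishes η → Vanishes κ-relation → Vanishes M-definition → Vanishes P-definition → Vanishes η-definition →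
      Vanishes (equalRootsPoly A β) ⊎ Vanishes (resultantPoly α β M P)
    singular⇒eliminant (i , xᵢ≉0) K≈0 ∂K≈0 η≉0 κ≈2β M≈ P≈ η≈ = by-W (x (# 3) ≟ 0#)
      where
      critX≈0 : Vanishes critX
      critX≈0 = from-∂X (∂K≈0 (# 1))
      critY≈0 : Vanishes critY
      critY≈0 = from-∂Y (∂K≈0 (# 2))

      all-zero-at-infinity : Vanishes W → ∀ i → x i ≈ 0#
      all-zero-at-infinity W≈0 Fin.zero = from-∂W-at-infinity (∂K≈0 (# 3)) η≉0 W≈0
      all-zero-at-infinity W≈0 (Fin.suc Fin.zero) =
        CriticalAtInfinity.critical-at-infinity (ι a ∷ ι b ∷ x (# 1) ∷ x (# 3) ∷ []) critX≈0 W≈0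
      all-zero-at-infinity W≈0 (Fin.suc (Fin.suc Fin.zero)) =
        CriticalAtInfinity.critical-at-infinity (ι a ∷ ι b ∷ x (# 2) ∷ x (# 3) ∷ []) critY≈0 W≈0
      all-zero-at-infinity W≈0 (Fin.suc (Fin.suc (Fin.suc Fin.zero))) = W≈0

      by-W : Dec (x (# 3) ≈ 0#) → Vanishes (equalRootsPoly A β) ⊎ Vanishes (resultantPoly α β M P)
      by-W (yes W≈0) = ⊥-elim (xᵢ≉0 (all-zero-at-infinity W≈0 i))
      by-W (no W≉0)  = affine⇒eliminant W≉0 η≉0 critX≈0 critY≈0
                         (eliminate-Z critZ≈0 (linear-in-Z K≈0 critZ≈0 critX≈0 critY≈0 κ≈2β)) M≈ P≈ η≈
        where
        critZ≈0 : Vanishes critZ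
        critZ≈0 = cancel W critZ W≉0 (from-∂Z (∂K≈0 (# 0)) η≉0)

module ParameterPolynomials where

  open import Data.Nat as ℕ using (ℕ; zero; suc)
  open import Data.Integer as ℤ using (ℤ; +_)
  open import Data.Fin using (Fin; #_; toℕ)
  open import Relation.Binary.PropositionalEquality using (_≡_; refl)
  open IntegerPolynomials
  open Polynomials

  power : IntPoly → ℕ → IntPoly
  power p zero          = cst (+ 1)
  power p (suc zero)    = p
  power p (suc (suc k)) = power p (suc k) ⊠ p

  toIntPoly : ∀ {n} → (Fin n → IntPoly) → Term n → IntPoly
  toIntPoly σ (Κ c)   = cst c
  toIntPoly σ (Ι i)   = σ i
  toIntPoly σ (p ⊕ q) = toIntPoly σ p ⊞ toIntPoly σ q
  toIntPoly σ (p ⊗ q) = toIntPoly σ p ⊠ toIntPoly σ q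
  toIntPoly σ (⊝ p)   = cst (ℤ.- + 1) ⊠ toIntPoly σ p
  toIntPoly σ (p ⊛ k) = power (toIntPoly σ p) k

  ηₚ Aₚ κₚ αₚ βₚ Mₚ Pₚ : Term 7
  ηₚ = Ι (# 0)
  Aₚ = Ι (# 1)
  κₚ = Ι (# 2)
  αₚ = Ι (# 3)
  βₚ = Ι (# 4)
  Mₚ = Ι (# 5)
  Pₚ = Ι (# 6)

  module _ (a b : ℤ) where
    private
      basic : Fin 7 → IntPoly
      basic i with toℕ i
      ... | 1 = varA
      ... | 3 = cst a
      ... | 4 = cst b
      ... | _ = cst (+ 0)

    Mtree : IntPoly
    Mtree = toIntPoly basic (Mpoly Aₚ αₚ βₚ)

    private
      withM : Fin 7 → IntPoly
      withM i with toℕ i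
      ... | 5 = Mtree
      ... | _ = basic i

    Ptree : IntPoly
    Ptree = toIntPoly withM (Ppoly Aₚ αₚ βₚ Mₚ)

    parameters : (η κ : ℤ) → Fin 7 → IntPoly
    parameters η κ i with toℕ i
    ... | 0 = cst η
    ... | 2 = cst κ
    ... | 6 = Ptree
    ... | _ = withM i

  A₅ α₅ β₅ M₅ P₅ : Term 5
  A₅ = Ι (# 0)
  α₅ = Ι (# 1)
  β₅ = Ι (# 2)
  M₅ = Ι (# 3)
  P₅ = Ι (# 4)

  eliminantVariables : (a b : ℤ) → Fin 5 → IntPoly
  eliminantVariables a b i with toℕ i
  ... | 0 = varA
  ... | 1 = cst a
  ... | 2 = cst b
  ... | 3 = Mtree a b
  ... | _ = Ptree a b

  equalRootsTree resultantTree : (a b : ℤ) → IntPoly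
  equalRootsTree a b = toIntPoly (eliminantVariables a b) (equalRootsPoly A₅ β₅)
  resultantTree a b = toIntPoly (eliminantVariables a b) (resultantPoly α₅ β₅ M₅ P₅)

  equalRoots-leading : ∀ a b → leading (equalRootsTree a b) ≡ + 1
  equalRoots-leading a b = refl

  resultant-leading : ∀ a b → leading (resultantTree a b) ≡ + 68719476736
  resultant-leading a b = refl

  eliminantBound : ℤ → ℤ → ℕ
  eliminantBound a b = bound (equalRootsTree a b) ℕ.⊔ bound (resultantTree a b)

module Transfer (R : CommutativeRing 0ℓ 0ℓ) where

  open import Algebra.Bundles using (RawRing)
  open import Data.Nat as ℕ using (zero; suc)
  open import Data.Integer as ℤ using (+_)
  import Data.Integer.Properties as ℤP
  open import Data.Fin using (Fin)
  open import Data.Vec using (tabulate)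
  open import Data.Vec.Properties using (lookup∘tabulate)
  open import Relation.Binary.PropositionalEquality as ≡ using (_≡_)

  open CommutativeRing R
  open IntegerCoefficients R
  open ℤSolver using (⟦_⟧)
  open IntegerPolynomials
  open ParameterPolynomials
  open Polynomials using (Term; Κ; Ι; _⊕_; _⊗_; ⊝_; _⊛_)
  open import Algebra.Definitions.RawSemiring (RawRing.rawSemiring rawRing) using (_^′_)

  ι-power : ∀ p k A → ι (eval (power p k) A) ≈ ι (eval p A) ^′ k
  ι-power p zero          A = +-identityʳ 1#
  ι-power p (suc zero)    A = refl
  ι-power p (suc (suc k)) A = trans (ι-* (eval (power p (suc k)) A) (eval p A)) (*-congʳ (ι-power p (suc k) A))

  ι-eval : ∀ {n} (σ : Fin n → IntPoly) (e : Term n) A →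
           ι (eval (toIntPoly σ e) A) ≈ ⟦ e ⟧ (tabulate (λ i → ι (eval (σ i) A)))
  ι-eval σ (Κ c)   A = refl
  ι-eval σ (Ι i)   A = reflexive (≡.sym (lookup∘tabulate (λ j → ι (eval (σ j) A)) i))
  ι-eval σ (p ⊕ q) A = trans (ι-+ (eval (toIntPoly σ p) A) _) (+-cong (ι-eval σ p A) (ι-eval σ q A))
  ι-eval σ (p ⊗ q) A = trans (ι-* (eval (toIntPoly σ p) A) _) (*-cong (ι-eval σ p A) (ι-eval σ q A))
  ι-eval σ (⊝ p)   A = begin
    ι (ℤ.- + 1 ℤ.* eval (toIntPoly σ p) A) ≡⟨ ≡.cong ι (ℤP.-1*i≡-i (eval (toIntPoly σ p) A)) ⟩
    ι (ℤ.- eval (toIntPoly σ p) A)         ≈⟨ ι-neg (eval (toIntPoly σ p) A) ⟩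
    - ι (eval (toIntPoly σ p) A)           ≈⟨ -‿cong (ι-eval σ p A) ⟩
    - ⟦ p ⟧ _                              ∎
    where open import Relation.Binary.Reasoning.Setoid setoid
  ι-eval σ (p ⊛ k) A = trans (ι-power (toIntPoly σ p) k A) (^′-cong k (ι-eval σ p A))
    where
    ^′-cong : ∀ k {u v} → u ≈ v → u ^′ k ≈ v ^′ k
    ^′-cong zero          u≈v = refl
    ^′-cong (suc zero)    u≈v = u≈v
    ^′-cong (suc (suc k)) u≈v = *-cong (^′-cong (suc k) u≈v) u≈v

module ParameterIdentities (a b : ℤ) (h₁ h₂ ρ : ℕ) (c : ℤ) where

  open import Data.Nat as ℕ using (ℕ)
  open import Data.Integer as ℤ using (ℤ; +_)
  import Data.Integer.Properties as ℤP
  open import Data.Fin using (Fin; #_)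
  open import Relation.Binary.PropositionalEquality as ≡ using (_≡_)
  open import Data.Integer.Solver using (module +-*-Solver)
  open import Data.Nat.Solver using () renaming (module +-*-Solver to ℕ-Solver)
  open import Defs using (Aconst)
  open IntegerPolynomials
  open ParameterPolynomials
  open Polynomials
  open +-*-Solver using (_:+_; _:*_; _:=_; con) renaming (solve to solveℤ)
  open ℕ-Solver using () renaming (_:*_ to _:*ₙ_; _:=_ to _:=ₙ_; solve to solveℕ)

  A : ℤ
  A = Aconst a h₁ h₂ ρ

  σ : Fin 7 → IntPoly
  σ = parameters a b (+ (h₁ ℕ.* h₂ ℕ.* ρ)) (+ h₂ ℤ.* c)

  -- x − x = 0 in the form produced by the translation of a difference
  cancels : ∀ i → i ℤ.+ ℤ.- + 1 ℤ.* i ≡ + 0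
  cancels = solveℤ 1 (λ i → i :+ con (ℤ.- + 1) :* i := con (+ 0)) ≡.refl

  difference-vanishes : ∀ {n} (τ : Fin n → IntPoly) i e A → τ i ≡ toIntPoly τ e → eval (toIntPoly τ (Ι i − e)) A ≡ + 0
  difference-vanishes τ i e A τi≡e =
    ≡.trans (≡.cong (λ t → eval t A ℤ.+ ℤ.- + 1 ℤ.* eval (toIntPoly τ e) A) τi≡e) (cancels (eval (toIntPoly τ e) A))

  M-identity : eval (toIntPoly σ (Mₚ − Mpoly Aₚ αₚ βₚ)) A ≡ + 0
  M-identity = difference-vanishes σ (# 5) (Mpoly Aₚ αₚ βₚ) A ≡.refl

  P-identity : eval (toIntPoly σ (Pₚ − Ppoly Aₚ αₚ βₚ Mₚ)) A ≡ + 0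
  P-identity = difference-vanishes σ (# 6) (Ppoly Aₚ αₚ βₚ Mₚ) A ≡.refl

  η-identity : eval (toIntPoly σ (ηₚ ^ 2 − Hpoly Aₚ αₚ)) A ≡ + 0
  η-identity = ≡.trans (≡.cong (λ t → N ℤ.* (N ℤ.* + 1) ℤ.+ ℤ.- + 1 ℤ.* ((t ℤ.+ + 2 ℤ.* a) ℤ.+ ℤ.- + 1 ℤ.* (+ 2 ℤ.* a))) square)
                 (solveℤ 2 (λ N a → N :* (N :* con (+ 1)) :+ con (ℤ.- + 1) :* ((N :* N :+ con (+ 2) :* a) :+ con (ℤ.- + 1) :* (con (+ 2) :* a))
                                   := con (+ 0)) ≡.refl N a)
    where
    N : ℤ
    N = + (h₁ ℕ.* h₂ ℕ.* ρ)
    square : + (h₁ ℕ.* h₁ ℕ.* h₂ ℕ.* h₂ ℕ.* ρ ℕ.* ρ) ≡ N ℤ.* N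
    square = ≡.trans (≡.cong +_ (solveℕ 3 (λ h₁ h₂ ρ → h₁ :*ₙ h₁ :*ₙ h₂ :*ₙ h₂ :*ₙ ρ :*ₙ ρ :=ₙ
                                                    (h₁ :*ₙ h₂ :*ₙ ρ) :*ₙ (h₁ :*ₙ h₂ :*ₙ ρ)) ≡.refl h₁ h₂ ρ))
                     (ℤP.pos-* (h₁ ℕ.* h₂ ℕ.* ρ) (h₁ ℕ.* h₂ ℕ.* ρ))

  κ-identity : + h₂ ℤ.* c ≡ + 2 ℤ.* b → eval (toIntPoly σ (κₚ − Κ (+ 2) ⊗ βₚ)) A ≡ + 0
  κ-identity h₂c≡2b = ≡.trans (≡.cong (λ t → t ℤ.+ ℤ.- + 1 ℤ.* (+ 2 ℤ.* b)) h₂c≡2b) (cancels (+ 2 ℤ.* b))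

module NonSingularity (F : AlgebraicClosureOfℚ 0ℓ 0ℓ) where

  open import Data.Nat as ℕ using (ℕ; _>_; NonZero)
  import Data.Nat.Properties as ℕP
  open import Data.Integer as ℤ using (ℤ; +_; ∣_∣)
  open import Data.Fin using (Fin)
  open import Data.Vec using (Vec; tabulate)
  open import Data.Product using (_,_)
  open import Data.Sum using (_⊎_; inj₁; inj₂)
  open import Data.Empty using (⊥)
  open import Relation.Nullary using (¬_)
  open import Relation.Binary.PropositionalEquality as ≡ using (_≡_)
  open import Defs using (Aconst; Kform; SingularPoint)
  open IntegerPolynomials
  open ParameterPolynomials
  open Polynomials
  open AlgebraicClosureOfℚ F using (R)
  open CommutativeRing R
  open IntegerCoefficients R
  open ℤSolver using (⟦_⟧)
  open FieldAlgebra F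
  open SingularPoints F
  open Transfer R

  no-singular-point : (a b : ℤ) (h₁ h₂ ρ : ℕ) → h₁ > 0 → h₂ > 0 → ρ > 0 → (c : ℤ) → + h₂ ℤ.* c ≡ + 2 ℤ.* b →
    ∣ Aconst a h₁ h₂ ρ ∣ > eliminantBound a b → (x : Fin 4 → Carrier) → ¬ SingularPoint R (Kform a b h₁ h₂ ρ c) x
  no-singular-point a b h₁ h₂ ρ h₁>0 h₂>0 ρ>0 c h₂c≡2b A>bound x (nonzero , K≈0 , ∂K≈0) =
    exclude (singular⇒eliminant nonzero (≡.subst (_≈ 0#) K-agrees K≈0) (λ i → ≡.subst (_≈ 0#) (∂K-agrees i) (∂K≈0 i))
               η≉0 κ≈2β M≈ P≈ η²≈)
    where
    open ParameterIdentities a b h₁ h₂ ρ c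
    open AtPoint a b h₁ h₂ ρ c x (ι (eval (Mtree a b) A)) (ι (eval (Ptree a b) A))
      using (K-agrees; ∂K-agrees; singular⇒eliminant)
    open Certificates (tabulate (λ i → ι (eval (σ i) A))) using () renaming (Vanishes to Holds)

    relation : ∀ e → eval (toIntPoly σ e) A ≡ + 0 → Holds e
    relation e e≡0 = trans (sym (ι-eval σ e A)) (reflexive (≡.cong ι e≡0))

    κ≈2β : Holds (κₚ − Κ (+ 2) ⊗ βₚ)
    κ≈2β = relation (κₚ − Κ (+ 2) ⊗ βₚ) (κ-identity h₂c≡2b)
    M≈ : Holds (Mₚ − Mpoly Aₚ αₚ βₚ)
    M≈ = relation (Mₚ − Mpoly Aₚ αₚ βₚ) M-identity
    P≈ : Holds (Pₚ − Ppoly Aₚ αₚ βₚ Mₚ)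
    P≈ = relation (Pₚ − Ppoly Aₚ αₚ βₚ Mₚ) P-identity
    η²≈ : Holds (ηₚ ^ 2 − Hpoly Aₚ αₚ)
    η²≈ = relation (ηₚ ^ 2 − Hpoly Aₚ αₚ) η-identity

    instance
      h₁≢0 : NonZero h₁
      h₁≢0 = ℕ.>-nonZero h₁>0
      h₂≢0 : NonZero h₂
      h₂≢0 = ℕ.>-nonZero h₂>0
      ρ≢0 : NonZero ρ
      ρ≢0 = ℕ.>-nonZero ρ>0

    η≉0 : ¬ ι (+ (h₁ ℕ.* h₂ ℕ.* ρ)) ≈ 0#
    η≉0 = ι-nonzero (h₁ ℕ.* h₂ ℕ.* ρ) {{ℕP.m*n≢0 (h₁ ℕ.* h₂) ρ {{ℕP.m*n≢0 h₁ h₂}}}}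

    root-beyond-bound : ∀ p → ¬ (leading p ≡ + 0) → bound p ℕ.≤ eliminantBound a b → ι (eval p A) ≈ 0# → ⊥
    root-beyond-bound p l≢0 b≤bound root = noLargeRoot p A l≢0 (ℕP.≤-<-trans b≤bound A>bound) (ι≈0⇒≡0 (eval p A) root)

    values₅ : Vec Carrier 5
    values₅ = tabulate (λ i → ι (eval (eliminantVariables a b i) A))

    +1≢0 : ¬ (+ 1 ≡ + 0)
    +1≢0 ()
    +2³⁶≢0 : ¬ (+ 68719476736 ≡ + 0)
    +2³⁶≢0 ()

    exclude : ⟦ equalRootsPoly A₅ β₅ ⟧ values₅ ≈ 0# ⊎ ⟦ resultantPoly α₅ β₅ M₅ P₅ ⟧ values₅ ≈ 0# → ⊥
    exclude (inj₁ e≈0) = root-beyond-bound (equalRootsTree a b) (λ l≡0 → +1≢0 (≡.trans (≡.sym (equalRoots-leading a b)) l≡0))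
                           (ℕP.m≤m⊔n _ _) (trans (ι-eval (eliminantVariables a b) (equalRootsPoly A₅ β₅) A) e≈0)
    exclude (inj₂ r≈0) = root-beyond-bound (resultantTree a b) (λ l≡0 → +2³⁶≢0 (≡.trans (≡.sym (resultant-leading a b)) l≡0))
                           (ℕP.m≤n⊔m _ _) (trans (ι-eval (eliminantVariables a b) (resultantPoly α₅ β₅ M₅ P₅) A) r≈0)

open import Defs
open import Data.Nat using (ℕ; _>_)
open import Data.Integer using (ℤ; +_; _*_; ∣_∣)
open import Data.Fin using (Fin)
open import Data.Product using (∃; _×_; _,_)
open import Relation.Nullary using (¬_)
open import Relation.Binary.PropositionalEquality using (_≡_)

lemma3 : (a b : ℤ) → ¬ (a ≡ + 0 × b ≡ + 0) →
    ∃ λ (C₀ : ℕ) →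
      (h₁ h₂ ρ : ℕ) → h₁ > 0 → h₂ > 0 → ρ > 0 →
      (c : ℤ) → + h₂ * c ≡ + 2 * b →
      ∣ Aconst a h₁ h₂ ρ ∣ > C₀ →
      (F : AlgebraicClosureOfℚ 0ℓ 0ℓ) →
      (x : Fin 4 → CommutativeRing.Carrier (AlgebraicClosureOfℚ.R F)) →
      ¬ SingularPoint (AlgebraicClosureOfℚ.R F) (Kform a b h₁ h₂ ρ c) x
lemma3 a b _ = ParameterPolynomials.eliminantBound a b ,
  λ h₁ h₂ ρ h₁>0 h₂>0 ρ>0 c h₂c≡2b A>C₀ F →
    NonSingularity.no-singular-point F a b h₁ h₂ ρ h₁>0 h₂>0 ρ>0 c h₂c≡2b A>C₀
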